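{- Let $k,l$ be positive integers with $k\ge l$. Then in $\mathbb{Z}[t]\otimes\Gamma'$, $$P_{k,l}(x|t)=P_k(x|t)P_l(x|t)+\sum_{(r,s)\in\mathcal{I}_{k,l}}g_{k,l}^{r,s}(t)P_r(x|t)P_s(x|t),$$ where $\mathcal{I}_{k,l}$ is the set of integer pairs $(r,s)\ne(k,l)$ with $k\le r\le k+l$, $0\le s\le l$, $r+s\le k+l$, and $g_{k,l}^{r,s}(t)=(-1)^{l-s}2h_{k+l-r-s}(t_{k+1},\dots,t_{r+1}|t_{s+2},\dots,t_l)$ if $s\ge1$, and $g_{k,l}^{r,s}(t)=(-1)^{l-s}h_{k+l-r-s}(t_{k+1},\dots,t_{r+1}|t_1,\dots,t_l)$ if $s=0$.
   Context: $x=(x_1,x_2,\dots)$, $t=(t_1,t_2,\dots)$ indeterminates, $\mathbb{Z}[t]=\mathbb{Z}[t_1,t_2,\dots]$, $\Gamma'=\mathbb{Z}[P_1(x),P_2(x),\dots]$ (Schur $P$-functions). With $(y|t)^k=(y-t_1)\cdots(y-t_k)$ and a sequence $\lambda=(\lambda_1,\dots,\lambda_\ell)$ of positive integers with $\ell\le N$, $P_\lambda(x_1,\dots,x_N|t)=\frac{1}{(N-\ell)!}\sum_{w\in S_N}w\big(\prod_{i=1}^\ell(x_i|t)^{\lambda_i}\prod_{i=1}^\ell\prod_{j=i+1}^N\frac{x_i+x_j}{x_i-x_j}\big)$ ($w$ permutes the $x_i$); $P_\lambda(x|t)$ is its projective limit over even $N$. $P_{k,l}=P_{(k,l)}$, $P_i=P_{(i)}$,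 $P_0=1$. $h_m(y_1,\dots,y_a|z_1,\dots,z_b)=\sum_{i+j=m}h_i(y_1,\dots,y_a)e_j(z_1,\dots,z_b)$ with $h_i$ complete homogeneous and $e_j$ elementary symmetric polynomials (lists may be empty). -}

module Defs where

open import Data.Nat as ℕ using (ℕ; zero; suc; _∸_; _≤?_; _<?_)
open import Data.Nat using (_!)
open import Data.Integer using (+_)
open import Data.Rational as ℚ using (ℚ; 0ℚ; 1ℚ; _+_; _*_; _-_; -_; 1/_; ≢-nonZero)
open import Data.Rational.Properties using () renaming (_≟_ to _≟ℚ_)
open import Data.Fin using (Fin; toℕ)
open import Data.Fin.Properties using () renaming (_≟_ to _≟F_)
open import Data.List using (List; []; _∷_; map; foldr; concatMap; upTo; allFin; filter; length)
open import Data.Vec as Vec using (Vec; lookup)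
open import Data.Bool using (Bool; true; false; if_then_else_; _∧_; not)
open import Relation.Nullary using (yes; no)
open import Relation.Nullary.Decidable using (⌊_⌋)

fromℕ : ℕ → ℚ
fromℕ n = (+ n) ℚ./ 1

-- Total division: p ÷' q = p / q if q ≠ 0, and 0 otherwise.
-- (Only ever used with nonzero denominators in the statement.)
_÷'_ : ℚ → ℚ → ℚ
p ÷' q with q ≟ℚ 0ℚ
... | yes _ = 0ℚ
... | no q≢0 = p * (1/_ q {{≢-nonZero q≢0}})

sgn : ℕ → ℚ
sgn zero = 1ℚ
sgn (suc n) = - sgn n

sumℚ : List ℚ → ℚ
sumℚ = foldr _+_ 0ℚ

prodℚ : List ℚ → ℚ
prodℚ = foldr _*_ 1ℚ

-- [a, a+1, ..., b]  (empty if a > b)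
range : ℕ → ℕ → List ℕ
range a b = map (a ℕ.+_) (upTo (suc b ∸ a))

hc : ℕ → List ℚ → ℚ
hc zero    _        = 1ℚ
hc (suc i) []       = 0ℚ
hc (suc i) (a ∷ as) = hc (suc i) as + a * hc i (a ∷ as)

el : ℕ → List ℚ → ℚ
el zero    _        = 1ℚ
el (suc j) []       = 0ℚ
el (suc j) (a ∷ as) = el (suc j) as + a * el j as

hh : ℕ → List ℚ → List ℚ → ℚ
hh m ys zs = sumℚ (map (λ i → hc i ys * el (m ∸ i) zs) (upTo (suc m)))

-- Parameters t = (t_1, t_2, ...) are given as a function t : ℕ → ℚ with
-- t_i = t i for i ≥ 1 (the value t 0 is never used).

tRange : (ℕ → ℚ) → ℕ → ℕ → List ℚ
tRange t a b = map t (range a b)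

fpow : (ℕ → ℚ) → ℚ → ℕ → ℚ
fpow t y k = prodℚ (map (λ i → y - t i) (range 1 k))

-- The symmetric group S_N, enumerated as the injective maps Fin N → Fin N
-- (given as vectors of their values).

allVecs : (n m : ℕ) → List (Vec (Fin n) m)
allVecs n zero    = Vec.[] ∷ []
allVecs n (suc m) = concatMap (λ v → map (λ a → a Vec.∷ v) (allFin n)) (allVecs n m)

isInjective : {n m : ℕ} → Vec (Fin n) m → Bool
isInjective {m = m} v =
  foldr _∧_ true
    (concatMap (λ i → map (λ j → ⌊ i ≟F j ⌋ ∨' not ⌊ lookup v i ≟F lookup v j ⌋) (allFin m)) (allFin m))
  where
  _∨'_ : Bool → Bool → Bool
  true ∨' _ = true
  false ∨' b = b

perms : (N : ℕ) → List (Vec (Fin N) N)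
perms N = filter (λ v → isInjective v ≟B true) (allVecs N N)
  where
  open import Data.Bool.Properties using () renaming (_≟_ to _≟B_)

-- Factorial Schur P-functions in N variables, evaluated at a point
-- x : Fin N → ℚ (variables x_1..x_N are x at indices 0..N-1).

lookupℕ : List ℕ → ℕ → ℕ
lookupℕ []       _       = 0
lookupℕ (a ∷ as) zero    = a
lookupℕ (a ∷ as) (suc i) = lookupℕ as i

Pterm : (N : ℕ) → (ℕ → ℚ) → List ℕ → (Fin N → ℚ) → ℚ
Pterm N t lam y =
  prodℚ (map factor (filter (λ i → toℕ i <? length lam) (allFin N)))
  where
  factor : Fin N → ℚ
  factor i =
    fpow t (y i) (lookupℕ lam (toℕ i))
    * prodℚ (map (λ j → (y i + y j) ÷' (y i - y j))
                 (filter (λ j → toℕ i <? toℕ j) (allFin N)))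

Pfun : (N : ℕ) → (ℕ → ℚ) → List ℕ → (Fin N → ℚ) → ℚ
Pfun N t lam x =
  (1ℚ ÷' fromℕ ((N ∸ length lam) !))
  * sumℚ (map (λ w → Pterm N t lam (λ i → x (lookup w i))) (perms N))

-- P_i with the convention P_0 = 1
P1 : (N : ℕ) → (ℕ → ℚ) → ℕ → (Fin N → ℚ) → ℚ
P1 N t zero    x = 1ℚ
P1 N t (suc i) x = Pfun N t (suc i ∷ []) x

two : ℚ
two = 1ℚ + 1ℚ

g : (ℕ → ℚ) → ℕ → ℕ → ℕ → ℕ → ℚ
g t k l r zero =
  sgn l * hh (k ℕ.+ l ∸ r) (tRange t (suc k) (suc r)) (tRange t 1 l)
g t k l r (suc s') =
  sgn (l ∸ suc s') * two
    * hh (k ℕ.+ l ∸ (r ℕ.+ suc s')) (tRange t (suc k) (suc r)) (tRange t (suc s' ℕ.+ 2) l)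

inI : ℕ → ℕ → ℕ → ℕ → Bool
inI k l r s =
  ⌊ k ≤? r ⌋ ∧ ⌊ r ≤? k ℕ.+ l ⌋ ∧ ⌊ s ≤? l ⌋ ∧ ⌊ r ℕ.+ s ≤? k ℕ.+ l ⌋
  ∧ not (⌊ r ℕ.≟ k ⌋ ∧ ⌊ s ℕ.≟ l ⌋)

correction : (N : ℕ) → (ℕ → ℚ) → ℕ → ℕ → (Fin N → ℚ) → ℚ
correction N t k l x =
  sumℚ (concatMap (λ r → map (λ s →
          if inI k l r s then g t k l r s * P1 N t r x * P1 N t s x else 0ℚ)
        (range 0 l)) (range k (k ℕ.+ l)))

{-# OPTIONS --safe #-}
-- For N distinct points x the symmetrisation over S_N collapses, up to the factor (N - ℓ)!, to sums over distinct
-- points. With w_a = ∏_{c ≠ a} (x_a + x_c)/(x_a - x_c) and w_{ab} = ∏_{c ∉ {a,b}} (x_b + x_c)/(x_b - x_c), put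
-- S₁ φ = Σ_a φ(x_a) w_a and S₂ (φ, ψ) = Σ_{a ≠ b} φ(x_a) ψ(x_b) w_a w_{ab}; then P_r = S₁ (y|t)^r and
-- P_{k,l} = S₂ ((y|t)^k, (y|t)^l). For distinct y₁ … y_m the sum Σᵢ ∏_{j ≠ i} (yᵢ + yⱼ)/(yᵢ - yⱼ) is m mod 2, so for
-- even N we get Σ_a w_a = 0 and Σ_b w_{ab} = 1. From w_a w_{ab} (x_a + x_b) = w_a w_b (x_b - x_a) follows
-- S₂ (yφ, ψ) + S₂ (φ, yψ) = S₁ φ · S₁ (yψ) - S₁ (yφ) · S₁ ψ; with (y|t)^{l+1} = (y - t_{l+1}) (y|t)^l this drives an
-- induction on l writing P_{k,l} as P_k P_l plus products of P_s with one-row sums of y^e ∏ (y + tᵢ) (y|t)^k.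
-- Expanding the latter in the factorial powers (y|t)^{k+j} produces the coefficients g_{k,l}^{r,s}(t).
module Submission where

open import Defs
open import Level using (0ℓ)
open import Data.Nat as ℕ using (ℕ; zero; suc; _∸_; _≤_; _<_; z≤n; s≤s; _≤?_; _<?_; _!)
import Data.Nat.Properties as ℕₚ
import Data.Nat.Tactic.RingSolver as ℕ-Solver
import Data.Nat.Coprimality as Coprimality
open import Data.Nat.Divisibility using (_∣_; divides)
open import Data.Nat.Combinatorics.Base using (_P′_)
open import Data.Nat.Combinatorics.Specification using (nP′n≡n!)
import Data.Integer as ℤ
import Data.Integer.Properties as ℤₚ
open import Data.Rational as ℚ using (ℚ; 0ℚ; 1ℚ; _+_; _*_; _-_; -_; ≢-nonZero)
import Data.Rational.Properties as ℚₚ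
open import Data.Bool using (Bool; true; false; if_then_else_; _∧_; _∨_; not)
import Data.Bool.Properties as Boolₚ
open import Data.Fin as Fin using (Fin; toℕ)
import Data.Fin.Properties as Finₚ
open import Data.List using (List; []; _∷_; [_]; map; length; _++_; concatMap; filter; foldr; upTo; applyUpTo; allFin)
open import Data.List.Properties
  using (map-applyUpTo; upTo-∷ʳ; map-++; map-∘; map-concatMap; length-map; length-upTo; length-++; length-tabulate;
         ++-assoc; filter-all; filter-none; filter-accept; filter-reject)
open import Data.List.Membership.Propositional using (_∈_; _∉_)
open import Data.List.Membership.Propositional.Properties
  using (∈-allFin; ∈-map⁺; ∈-map⁻; ∈-filter⁺; ∈-filter⁻; ∈-concatMap⁺; ∈-concatMap⁻)
open import Data.List.Relation.Unary.Any as Any using (here; there)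
open import Data.List.Relation.Unary.All as All using (All)
import Data.List.Relation.Unary.All.Properties as Allₚ
open import Data.List.Relation.Unary.AllPairs as AllPairs using (AllPairs; []; _∷_)
import Data.List.Relation.Unary.AllPairs.Properties as AllPairsₚ
open import Data.List.Relation.Unary.Unique.Propositional using (Unique)
import Data.List.Relation.Unary.Unique.Propositional.Properties as Uniqueₚ
open import Data.Vec as Vec using (Vec; toList; lookup)
open import Data.Product using (Σ; ∃; _×_; _,_; proj₁; proj₂; uncurry; map₂)
open import Data.Empty using (⊥; ⊥-elim)
open import Function using (_∘_)
open import Relation.Nullary using (Dec; ¬_; yes; no; does; ¬?)
open import Relation.Nullary.Decidable using (⌊_⌋; isYes≗does; dec-true; dec-false)
open import Relation.Nullary.Decidable.Core using (dec⇒maybe)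
open import Relation.Unary using (Decidable)
open import Relation.Binary.Definitions using (DecidableEquality)
open import Relation.Binary.PropositionalEquality hiding ([_])
open import Tactic.RingSolver using (solve-∀)
import Tactic.RingSolver.Core.AlmostCommutativeRing as ACR
open ≡-Reasoning

ℚ-ring : ACR.AlmostCommutativeRing 0ℓ 0ℓ
ℚ-ring = ACR.fromCommutativeRing ℚₚ.+-*-commutativeRing (λ q → dec⇒maybe (0ℚ ℚₚ.≟ q))

_⁻¹ : ℚ → ℚ
q ⁻¹ = 1ℚ ÷' q

÷'-≡-*⁻¹ : ∀ p q → p ÷' q ≡ p * q ⁻¹
÷'-≡-*⁻¹ p q with q ℚₚ.≟ 0ℚ
... | yes _ = sym (ℚₚ.*-zeroʳ p)
... | no _  = cong (p *_) (sym (ℚₚ.*-identityˡ _))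

*-inverseʳ′ : ∀ q → q ≢ 0ℚ → q * q ⁻¹ ≡ 1ℚ
*-inverseʳ′ q q≢0 with q ℚₚ.≟ 0ℚ
... | yes q≡0 = ⊥-elim (q≢0 q≡0)
... | no q≢0′ = trans (cong (q *_) (ℚₚ.*-identityˡ _)) (ℚₚ.*-inverseʳ q {{≢-nonZero q≢0′}})

*-inverseˡ′ : ∀ q → q ≢ 0ℚ → q ⁻¹ * q ≡ 1ℚ
*-inverseˡ′ q q≢0 = trans (ℚₚ.*-comm (q ⁻¹) q) (*-inverseʳ′ q q≢0)

÷'-*-cancel : ∀ p q → q ≢ 0ℚ → (p ÷' q) * q ≡ p
÷'-*-cancel p q q≢0 = begin
  (p ÷' q) * q    ≡⟨ cong (_* q) (÷'-≡-*⁻¹ p q) ⟩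
  p * q ⁻¹ * q    ≡⟨ ℚₚ.*-assoc p _ _ ⟩
  p * (q ⁻¹ * q)  ≡⟨ cong (p *_) (*-inverseˡ′ q q≢0) ⟩
  p * 1ℚ          ≡⟨ ℚₚ.*-identityʳ p ⟩
  p               ∎

1÷'-*-cancelˡ : ∀ q p → q ≢ 0ℚ → (1ℚ ÷' q) * (q * p) ≡ p
1÷'-*-cancelˡ q p q≢0 = begin
  (1ℚ ÷' q) * (q * p)   ≡⟨ sym (ℚₚ.*-assoc (1ℚ ÷' q) q p) ⟩
  (1ℚ ÷' q) * q * p     ≡⟨ cong (_* p) (÷'-*-cancel 1ℚ q q≢0) ⟩
  1ℚ * p                ≡⟨ ℚₚ.*-identityˡ p ⟩
  p                     ∎

*-≢0 : ∀ a b → a ≢ 0ℚ → b ≢ 0ℚ → a * b ≢ 0ℚ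
*-≢0 a b a≢0 b≢0 ab≡0 = ℚₚ.1≢0 (begin
  1ℚ                        ≡⟨ sym (cong₂ _*_ (*-inverseʳ′ a a≢0) (*-inverseʳ′ b b≢0)) ⟩
  (a * a ⁻¹) * (b * b ⁻¹)   ≡⟨ interchange a b (a ⁻¹) (b ⁻¹) ⟩
  (a * b) * (a ⁻¹ * b ⁻¹)   ≡⟨ cong (_* (a ⁻¹ * b ⁻¹)) ab≡0 ⟩
  0ℚ * (a ⁻¹ * b ⁻¹)        ≡⟨ ℚₚ.*-zeroˡ (a ⁻¹ * b ⁻¹) ⟩
  0ℚ                        ∎)
  where
  interchange : ∀ a b c d → (a * c) * (b * d) ≡ (a * b) * (c * d)
  interchange = solve-∀ ℚ-ring

*-cancelʳ-≢0 : ∀ a b c → c ≢ 0ℚ → a * c ≡ b * c → a ≡ b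
*-cancelʳ-≢0 a b c c≢0 ac≡bc = begin
  a                 ≡⟨ sym (ℚₚ.*-identityʳ a) ⟩
  a * 1ℚ            ≡⟨ cong (a *_) (sym (*-inverseʳ′ c c≢0)) ⟩
  a * (c * c ⁻¹)    ≡⟨ sym (ℚₚ.*-assoc a c _) ⟩
  a * c * c ⁻¹      ≡⟨ cong (_* c ⁻¹) ac≡bc ⟩
  b * c * c ⁻¹      ≡⟨ ℚₚ.*-assoc b c _ ⟩
  b * (c * c ⁻¹)    ≡⟨ cong (b *_) (*-inverseʳ′ c c≢0) ⟩
  b * 1ℚ            ≡⟨ ℚₚ.*-identityʳ b ⟩
  b                 ∎

p-q≡0⇒p≡q : ∀ p q → p - q ≡ 0ℚ → p ≡ q
p-q≡0⇒p≡q p q p-q≡0 = begin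
  p            ≡⟨ split p q ⟩
  (p - q) + q  ≡⟨ cong (_+ q) p-q≡0 ⟩
  0ℚ + q       ≡⟨ ℚₚ.+-identityˡ q ⟩
  q            ∎
  where
  split : ∀ p q → p ≡ (p - q) + q
  split = solve-∀ ℚ-ring

sumℚ-++ : ∀ xs ys → sumℚ (xs ++ ys) ≡ sumℚ xs + sumℚ ys
sumℚ-++ []       ys = sym (ℚₚ.+-identityˡ _)
sumℚ-++ (x ∷ xs) ys = trans (cong (x +_) (sumℚ-++ xs ys)) (sym (ℚₚ.+-assoc x _ _))

sum-concatMap : ∀ {A : Set} (g : A → List ℚ) xs → sumℚ (concatMap g xs) ≡ sumℚ (map (λ a → sumℚ (g a)) xs)
sum-concatMap g []       = refl
sum-concatMap g (x ∷ xs) = trans (sumℚ-++ (g x) (concatMap g xs)) (cong (sumℚ (g x) +_) (sum-concatMap g xs))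

module _ {A : Set} where

  sum-cong : ∀ (f g : A → ℚ) xs → (∀ a → a ∈ xs → f a ≡ g a) → sumℚ (map f xs) ≡ sumℚ (map g xs)
  sum-cong f g []       f≡g = refl
  sum-cong f g (x ∷ xs) f≡g = cong₂ _+_ (f≡g x (here refl)) (sum-cong f g xs (λ a a∈ → f≡g a (there a∈)))

  sum-ext : ∀ (f g : A → ℚ) xs → (∀ a → f a ≡ g a) → sumℚ (map f xs) ≡ sumℚ (map g xs)
  sum-ext f g xs f≡g = sum-cong f g xs (λ a _ → f≡g a)

  prod-cong : ∀ (f g : A → ℚ) xs → (∀ a → a ∈ xs → f a ≡ g a) → prodℚ (map f xs) ≡ prodℚ (map g xs)
  prod-cong f g []       f≡g = refl
  prod-cong f g (x ∷ xs) f≡g = cong₂ _*_ (f≡g x (here refl)) (prod-cong f g xs (λ a a∈ → f≡g a (there a∈)))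

  sum-0 : ∀ (f : A → ℚ) xs → (∀ a → a ∈ xs → f a ≡ 0ℚ) → sumℚ (map f xs) ≡ 0ℚ
  sum-0 f xs f≡0 = trans (sum-cong f (λ _ → 0ℚ) xs f≡0) (zeros xs)
    where
    zeros : ∀ (xs : List A) → sumℚ (map (λ _ → 0ℚ) xs) ≡ 0ℚ
    zeros []       = refl
    zeros (_ ∷ xs) = trans (ℚₚ.+-identityˡ _) (zeros xs)

  sum-+ : ∀ (f g : A → ℚ) xs → sumℚ (map (λ a → f a + g a) xs) ≡ sumℚ (map f xs) + sumℚ (map g xs)
  sum-+ f g []       = refl
  sum-+ f g (x ∷ xs) = trans (cong (f x + g x +_) (sum-+ f g xs)) (interchange (f x) (g x) _ _)
    where
    interchange : ∀ a b c d → (a + b) + (c + d) ≡ (a + c) + (b + d)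
    interchange = solve-∀ ℚ-ring

  sum-*ˡ : ∀ c (f : A → ℚ) xs → sumℚ (map (λ a → c * f a) xs) ≡ c * sumℚ (map f xs)
  sum-*ˡ c f []       = sym (ℚₚ.*-zeroʳ c)
  sum-*ˡ c f (x ∷ xs) = trans (cong (c * f x +_) (sum-*ˡ c f xs)) (sym (ℚₚ.*-distribˡ-+ c (f x) _))

  sum-*ʳ : ∀ c (f : A → ℚ) xs → sumℚ (map (λ a → f a * c) xs) ≡ sumℚ (map f xs) * c
  sum-*ʳ c f xs = trans (sum-ext _ _ xs (λ a → ℚₚ.*-comm (f a) c)) (trans (sum-*ˡ c f xs) (ℚₚ.*-comm c _))

  sum-neg : ∀ (f : A → ℚ) xs → sumℚ (map (λ a → - f a) xs) ≡ - sumℚ (map f xs)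
  sum-neg f []       = refl
  sum-neg f (x ∷ xs) = trans (cong (- f x +_) (sum-neg f xs)) (sym (ℚₚ.neg-distrib-+ (f x) _))

  sum-sub : ∀ (f g : A → ℚ) xs → sumℚ (map (λ a → f a - g a) xs) ≡ sumℚ (map f xs) - sumℚ (map g xs)
  sum-sub f g xs = trans (sum-+ f (λ a → - g a) xs) (cong (sumℚ (map f xs) +_) (sum-neg g xs))


  prod-++ : ∀ (f : A → ℚ) xs ys → prodℚ (map f (xs ++ ys)) ≡ prodℚ (map f xs) * prodℚ (map f ys)
  prod-++ f []       ys = sym (ℚₚ.*-identityˡ _)
  prod-++ f (x ∷ xs) ys = trans (cong (f x *_) (prod-++ f xs ys)) (sym (ℚₚ.*-assoc (f x) _ _))

  prod-* : ∀ (f g : A → ℚ) xs → prodℚ (map (λ a → f a * g a) xs) ≡ prodℚ (map f xs) * prodℚ (map g xs)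
  prod-* f g []       = refl
  prod-* f g (x ∷ xs) = trans (cong (f x * g x *_) (prod-* f g xs)) (interchange (f x) (g x) _ _)
    where
    interchange : ∀ a b c d → (a * b) * (c * d) ≡ (a * c) * (b * d)
    interchange = solve-∀ ℚ-ring

  prod-≢0 : ∀ (f : A → ℚ) xs → (∀ a → a ∈ xs → f a ≢ 0ℚ) → prodℚ (map f xs) ≢ 0ℚ
  prod-≢0 f []       _   = λ ()
  prod-≢0 f (x ∷ xs) f≢0 = *-≢0 _ _ (f≢0 x (here refl)) (prod-≢0 f xs (λ a a∈ → f≢0 a (there a∈)))

module _ {A B : Set} where

  sum-map : ∀ (f : B → ℚ) (g : A → B) xs → sumℚ (map f (map g xs)) ≡ sumℚ (map (f ∘ g) xs)
  sum-map f g xs = cong sumℚ (sym (map-∘ xs))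

  prod-map : ∀ (f : B → ℚ) (g : A → B) xs → prodℚ (map f (map g xs)) ≡ prodℚ (map (f ∘ g) xs)
  prod-map f g xs = cong prodℚ (sym (map-∘ xs))

  sum-swap : ∀ (f : A → B → ℚ) xs ys →
             sumℚ (map (λ a → sumℚ (map (f a) ys)) xs) ≡ sumℚ (map (λ b → sumℚ (map (λ a → f a b) xs)) ys)
  sum-swap f []       ys = sym (sum-0 _ ys (λ _ _ → refl))
  sum-swap f (x ∷ xs) ys = trans (cong (sumℚ (map (f x) ys) +_) (sum-swap f xs ys))
                                 (sym (sum-+ (f x) (λ b → sumℚ (map (λ a → f a b) xs)) ys))

indicator : Bool → ℚ
indicator true  = 1ℚ
indicator false = 0ℚ

indicator-not : ∀ b → indicator (not b) ≡ 1ℚ - indicator b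
indicator-not true  = refl
indicator-not false = refl

sum-filter : ∀ {A : Set} {P : A → Set} (P? : Decidable P) (f : A → ℚ) xs →
             sumℚ (map f (filter P? xs)) ≡ sumℚ (map (λ a → indicator (does (P? a)) * f a) xs)
sum-filter P? f []       = refl
sum-filter P? f (x ∷ xs) with does (P? x)
... | true  = cong₂ _+_ (sym (ℚₚ.*-identityˡ (f x))) (sum-filter P? f xs)
... | false = trans (sum-filter P? f xs) (trans (sym (ℚₚ.+-identityˡ _)) (cong (_+ _) (sym (ℚₚ.*-zeroˡ (f x)))))

Σ< : ℕ → (ℕ → ℚ) → ℚ
Σ< zero    G = 0ℚ
Σ< (suc n) G = G 0 + Σ< n (G ∘ suc)

sum-applyUpTo : ∀ {A : Set} (F : A → ℚ) (f : ℕ → A) n → sumℚ (map F (applyUpTo f n)) ≡ Σ< n (F ∘ f)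
sum-applyUpTo F f zero    = refl
sum-applyUpTo F f (suc n) = cong (F (f 0) +_) (sum-applyUpTo F (f ∘ suc) n)

sum-range : ∀ (F : ℕ → ℚ) a b → sumℚ (map F (range a b)) ≡ Σ< (suc b ∸ a) (λ i → F (a ℕ.+ i))
sum-range F a b = trans (cong (sumℚ ∘ map F) (map-applyUpTo (λ i → i) (a ℕ.+_) (suc b ∸ a)))
                        (sum-applyUpTo F (a ℕ.+_) (suc b ∸ a))

Σ<-snoc : ∀ n G → Σ< (suc n) G ≡ Σ< n G + G n
Σ<-snoc zero    G = trans (ℚₚ.+-identityʳ (G 0)) (sym (ℚₚ.+-identityˡ (G 0)))
Σ<-snoc (suc n) G = trans (cong (G 0 +_) (Σ<-snoc n (G ∘ suc))) (sym (ℚₚ.+-assoc (G 0) _ _))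

Σ<-split : ∀ a b G → Σ< (a ℕ.+ b) G ≡ Σ< a G + Σ< b (λ i → G (a ℕ.+ i))
Σ<-split zero    b G = sym (ℚₚ.+-identityˡ _)
Σ<-split (suc a) b G = trans (cong (G 0 +_) (Σ<-split a b (G ∘ suc))) (sym (ℚₚ.+-assoc (G 0) _ _))

Σ<-cong : ∀ n G H → (∀ i → i < n → G i ≡ H i) → Σ< n G ≡ Σ< n H
Σ<-cong zero    G H G≡H = refl
Σ<-cong (suc n) G H G≡H =
  cong₂ _+_ (G≡H 0 (s≤s z≤n)) (Σ<-cong n (G ∘ suc) (H ∘ suc) (λ i i<n → G≡H (suc i) (s≤s i<n)))

Σ<-ext : ∀ n G H → (∀ i → G i ≡ H i) → Σ< n G ≡ Σ< n H
Σ<-ext n G H G≡H = Σ<-cong n G H (λ i _ → G≡H i)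

Σ<-0 : ∀ n G → (∀ i → i < n → G i ≡ 0ℚ) → Σ< n G ≡ 0ℚ
Σ<-0 zero    G G≡0 = refl
Σ<-0 (suc n) G G≡0 =
  cong₂ _+_ (G≡0 0 (s≤s z≤n)) (Σ<-0 n (G ∘ suc) (λ i i<n → G≡0 (suc i) (s≤s i<n)))

Σ<-+ : ∀ n G H → Σ< n (λ i → G i + H i) ≡ Σ< n G + Σ< n H
Σ<-+ zero    G H = refl
Σ<-+ (suc n) G H = trans (cong (G 0 + H 0 +_) (Σ<-+ n (G ∘ suc) (H ∘ suc))) (interchange (G 0) (H 0) _ _)
  where
  interchange : ∀ a b c d → (a + b) + (c + d) ≡ (a + c) + (b + d)
  interchange = solve-∀ ℚ-ring

Σ<-*ˡ : ∀ n c G → Σ< n (λ i → c * G i) ≡ c * Σ< n G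
Σ<-*ˡ zero    c G = sym (ℚₚ.*-zeroʳ c)
Σ<-*ˡ (suc n) c G = trans (cong (c * G 0 +_) (Σ<-*ˡ n c (G ∘ suc))) (sym (ℚₚ.*-distribˡ-+ c (G 0) _))

Σ<-neg : ∀ n G → Σ< n (λ i → - G i) ≡ - Σ< n G
Σ<-neg zero    G = refl
Σ<-neg (suc n) G = trans (cong (- G 0 +_) (Σ<-neg n (G ∘ suc))) (sym (ℚₚ.neg-distrib-+ (G 0) _))

m∸n≡suc[m∸suc[n]] : ∀ m n → n < m → m ∸ n ≡ suc (m ∸ suc n)
m∸n≡suc[m∸suc[n]] (suc m) zero    _         = refl
m∸n≡suc[m∸suc[n]] (suc m) (suc n) (s≤s n<m) = m∸n≡suc[m∸suc[n]] m n n<m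

range-snoc : ∀ a b → a ≤ suc b → range a (suc b) ≡ range a b ++ [ suc b ]
range-snoc a b a≤1+b = begin
  map (a ℕ.+_) (upTo (suc (suc b) ∸ a))          ≡⟨ cong (map (a ℕ.+_) ∘ upTo) (ℕₚ.+-∸-assoc 1 a≤1+b) ⟩
  map (a ℕ.+_) (upTo (suc (suc b ∸ a)))          ≡⟨ cong (map (a ℕ.+_)) (sym (upTo-∷ʳ (suc b ∸ a))) ⟩
  map (a ℕ.+_) (upTo (suc b ∸ a) ++ [ suc b ∸ a ]) ≡⟨ map-++ (a ℕ.+_) (upTo (suc b ∸ a)) _ ⟩
  range a b ++ [ a ℕ.+ (suc b ∸ a) ]             ≡⟨ cong (λ c → range a b ++ [ c ]) (ℕₚ.m+[n∸m]≡n a≤1+b) ⟩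
  range a b ++ [ suc b ]                         ∎

range-empty : ∀ b → range (suc b) b ≡ []
range-empty b = cong (map (suc b ℕ.+_) ∘ upTo) (ℕₚ.n∸n≡0 b)

prod-range-snoc : ∀ f a b → a ≤ suc b →
                  prodℚ (map f (range a (suc b))) ≡ prodℚ (map f (range a b)) * f (suc b)
prod-range-snoc f a b a≤1+b = begin
  prodℚ (map f (range a (suc b)))                    ≡⟨ cong (prodℚ ∘ map f) (range-snoc a b a≤1+b) ⟩
  prodℚ (map f (range a b ++ [ suc b ]))             ≡⟨ prod-++ f (range a b) [ suc b ] ⟩
  prodℚ (map f (range a b)) * (f (suc b) * 1ℚ)       ≡⟨ cong (prodℚ (map f (range a b)) *_) (ℚₚ.*-identityʳ _) ⟩
  prodℚ (map f (range a b)) * f (suc b)              ∎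

fpow-suc : ∀ t y k → fpow t y (suc k) ≡ fpow t y k * (y - t (suc k))
fpow-suc t y k = prod-range-snoc (λ i → y - t i) 1 k (s≤s z≤n)

y*fpow : ∀ t y k → y * fpow t y k ≡ fpow t y (suc k) + t (suc k) * fpow t y k
y*fpow t y k = trans (expand y (t (suc k)) (fpow t y k)) (cong (_+ t (suc k) * fpow t y k) (sym (fpow-suc t y k)))
  where
  expand : ∀ y a f → y * f ≡ f * (y - a) + a * f
  expand = solve-∀ ℚ-ring

tSeg : (ℕ → ℚ) → ℕ → ℕ → List ℚ
tSeg t a n = map t (map (a ℕ.+_) (upTo n))

tSeg-suc : ∀ t a n → tSeg t a (suc n) ≡ t a ∷ tSeg t (suc a) n
tSeg-suc t a n = cong₂ _∷_ (cong t (ℕₚ.+-identityʳ a)) (begin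
  map t (map (a ℕ.+_) (applyUpTo suc n))         ≡⟨ cong (map t) (map-applyUpTo suc (a ℕ.+_) n) ⟩
  map t (applyUpTo (λ i → a ℕ.+ suc i) n)        ≡⟨ cong (map t) (applyUpTo-cong n (ℕₚ.+-suc a)) ⟩
  map t (applyUpTo (suc a ℕ.+_) n)               ≡⟨ cong (map t) (sym (map-applyUpTo (λ i → i) (suc a ℕ.+_) n)) ⟩
  map t (map (suc a ℕ.+_) (upTo n))              ∎)
  where
  applyUpTo-cong : ∀ {A : Set} {f g : ℕ → A} n → (∀ i → f i ≡ g i) → applyUpTo f n ≡ applyUpTo g n
  applyUpTo-cong zero    f≡g = refl
  applyUpTo-cong (suc n) f≡g = cong₂ _∷_ (f≡g 0) (applyUpTo-cong n (f≡g ∘ suc))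

length-tRange : ∀ t a b → length (tRange t a b) ≡ suc b ∸ a
length-tRange t a b =
  trans (length-map t (range a b)) (trans (length-map (a ℕ.+_) (upTo (suc b ∸ a))) (length-upTo (suc b ∸ a)))

hh-Σ : ∀ m ys zs → hh m ys zs ≡ Σ< (suc m) (λ i → hc i ys * el (m ∸ i) zs)
hh-Σ m ys zs = sum-applyUpTo (λ i → hc i ys * el (m ∸ i) zs) (λ i → i) (suc m)

hh-[] : ∀ m ys → hh m ys [] ≡ hc m ys
hh-[] m ys = begin
  hh m ys []                                                        ≡⟨ hh-Σ m ys [] ⟩
  Σ< (suc m) (λ i → hc i ys * el (m ∸ i) [])                         ≡⟨ Σ<-snoc m _ ⟩
  Σ< m (λ i → hc i ys * el (m ∸ i) []) + hc m ys * el (m ∸ m) []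
                                                                    ≡⟨ cong₂ _+_ (Σ<-0 m _ below-m) (cong (λ j → hc m ys * el j []) (ℕₚ.n∸n≡0 m)) ⟩
  0ℚ + hc m ys * 1ℚ                                                  ≡⟨ simplify (hc m ys) ⟩
  hc m ys                                                           ∎
  where
  below-m : ∀ i → i < m → hc i ys * el (m ∸ i) [] ≡ 0ℚ
  below-m i i<m rewrite m∸n≡suc[m∸suc[n]] m i i<m = ℚₚ.*-zeroʳ (hc i ys)
  simplify : ∀ a → 0ℚ + a * 1ℚ ≡ a
  simplify = solve-∀ ℚ-ring

hh-∷ : ∀ m ys z zs → hh (suc m) ys (z ∷ zs) ≡ hh (suc m) ys zs + z * hh m ys zs
hh-∷ m ys z zs = begin
  hh (suc m) ys (z ∷ zs)                                   ≡⟨ hh-Σ (suc m) ys (z ∷ zs) ⟩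
  Σ< (suc (suc m)) F                                       ≡⟨ Σ<-snoc (suc m) F ⟩
  Σ< (suc m) F + F (suc m)                                 ≡⟨ cong₂ _+_ (Σ<-cong (suc m) F (λ i → G i + z * H i) split) (top (z ∷ zs)) ⟩
  Σ< (suc m) (λ i → G i + z * H i) + hc (suc m) ys * 1ℚ    ≡⟨ cong (_+ hc (suc m) ys * 1ℚ) (Σ<-+ (suc m) G (λ i → z * H i)) ⟩
  Σ< (suc m) G + Σ< (suc m) (λ i → z * H i) + hc (suc m) ys * 1ℚ
                                                           ≡⟨ cong (λ s → Σ< (suc m) G + s + hc (suc m) ys * 1ℚ) (Σ<-*ˡ (suc m) z H) ⟩
  Σ< (suc m) G + z * Σ< (suc m) H + hc (suc m) ys * 1ℚ     ≡⟨ swap-last (Σ< (suc m) G) (z * Σ< (suc m) H) (hc (suc m) ys * 1ℚ) ⟩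
  (Σ< (suc m) G + hc (suc m) ys * 1ℚ) + z * Σ< (suc m) H   ≡⟨ cong₂ (λ u v → (Σ< (suc m) G + u) + z * v) (sym (top zs)) (sym (hh-Σ m ys zs)) ⟩
  (Σ< (suc m) G + G (suc m)) + z * hh m ys zs              ≡⟨ cong (_+ z * hh m ys zs) (sym (trans (hh-Σ (suc m) ys zs) (Σ<-snoc (suc m) G))) ⟩
  hh (suc m) ys zs + z * hh m ys zs                        ∎
  where
  F G H : ℕ → ℚ
  F i = hc i ys * el (suc m ∸ i) (z ∷ zs)
  G i = hc i ys * el (suc m ∸ i) zs
  H i = hc i ys * el (m ∸ i) zs
  top : ∀ ws → hc (suc m) ys * el (suc m ∸ suc m) ws ≡ hc (suc m) ys * 1ℚ
  top ws = cong (λ j → hc (suc m) ys * el j ws) (ℕₚ.n∸n≡0 (suc m))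
  split : ∀ i → i < suc m → F i ≡ G i + z * H i
  split i i<1+m rewrite m∸n≡suc[m∸suc[n]] (suc m) i i<1+m = distrib (hc i ys) (el (suc (m ∸ i)) zs) z (el (m ∸ i) zs)
    where
    distrib : ∀ a b z c → a * (b + z * c) ≡ a * b + z * (a * c)
    distrib = solve-∀ ℚ-ring
  swap-last : ∀ a b c → a + b + c ≡ (a + c) + b
  swap-last = solve-∀ ℚ-ring

-- The parity of Σᵢ ∏_{j ≠ i} (yᵢ + yⱼ)/(yᵢ - yⱼ)

Π⁺ Π⁻ : ℚ → List ℚ → ℚ
Π⁺ z cs = prodℚ (map (λ c → z + c) cs)
Π⁻ z cs = prodℚ (map (λ c → z - c) cs)

factor : ℚ → ℚ → ℚ
factor b c = (b + c) ÷' (b - c)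

weight : ℚ → List ℚ → ℚ
weight b cs = prodℚ (map (factor b) cs)

selections : {A : Set} → List A → List (A × List A)
selections []       = []
selections (y ∷ ys) = (y , ys) ∷ map (map₂ (y ∷_)) (selections ys)

weightSum : List ℚ → ℚ
weightSum ys = sumℚ (map (uncurry weight) (selections ys))

lagrangeSum : ℚ → List ℚ → ℚ
lagrangeSum z ys = sumℚ (map (λ (b , cs) → weight b cs * Π⁻ z cs) (selections ys))

parity : ℕ → ℚ
parity zero    = 0ℚ
parity (suc n) = 1ℚ - parity n

Distinct : List ℚ → Set
Distinct = AllPairs _≢_

selection-∈ : ∀ {A : Set} (ys : List A) {b cs} → (b , cs) ∈ selections ys → b ∈ ys
selection-∈ (y ∷ ys) (here refl) = here refl
selection-∈ (y ∷ ys) (there s∈) with ∈-map⁻ _ s∈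
... | _ , s′∈ , refl = there (selection-∈ ys s′∈)

selection-Π⁻ : ∀ ys {b cs} → (b , cs) ∈ selections ys → ∀ z → Π⁻ z ys ≡ (z - b) * Π⁻ z cs
selection-Π⁻ (y ∷ ys) (here refl) z = refl
selection-Π⁻ (y ∷ ys) (there s∈) z with ∈-map⁻ _ s∈
... | (b , cs) , s′∈ , refl = begin
  (z - y) * Π⁻ z ys              ≡⟨ cong ((z - y) *_) (selection-Π⁻ ys s′∈ z) ⟩
  (z - y) * ((z - b) * Π⁻ z cs)  ≡⟨ swap (z - y) (z - b) (Π⁻ z cs) ⟩
  (z - b) * ((z - y) * Π⁻ z cs)  ∎
  where
  swap : ∀ a b c → a * (b * c) ≡ b * (a * c)
  swap = solve-∀ ℚ-ring

-- The strengthened induction hypothesis for weightSum-parity: at z = y it computes the weight of a new point y.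
PlusMinusIdentity : List ℚ → Set
PlusMinusIdentity ys = ∀ z → Π⁺ z ys ≡ (1ℚ - two * weightSum ys) * Π⁻ z ys + two * z * lagrangeSum z ys

-- Adding a point y: every old weight wᵢ gets the factor (yᵢ + y)/(yᵢ - y) = 1 - 2y/(y - yᵢ), and the new weight
-- is 1 - 2T + 2yV with V = Σᵢ wᵢ/(y - yᵢ), so the weights now sum to 1 - T.
module ParityStep (y : ℚ) (ys : List ℚ) (y∉ys : All (y ≢_) ys) (identity : PlusMinusIdentity ys) where

  T = weightSum ys

  y-c≢0 : ∀ {c} → c ∈ ys → y - c ≢ 0ℚ
  y-c≢0 c∈ y-c≡0 = All.lookup y∉ys c∈ (p-q≡0⇒p≡q _ _ y-c≡0)

  y-b≢0 : ∀ {b cs} → (b , cs) ∈ selections ys → y - b ≢ 0ℚ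
  y-b≢0 s∈ = y-c≢0 (selection-∈ ys s∈)

  V : ℚ
  V = sumℚ (map (λ (b , cs) → weight b cs * (y - b) ⁻¹) (selections ys))

  weight-y : weight y ys ≡ 1ℚ - two * T + two * y * V
  weight-y = *-cancelʳ-≢0 _ _ (Π⁻ y ys) (prod-≢0 _ ys (λ c c∈ → y-c≢0 c∈)) (begin
    weight y ys * Π⁻ y ys                                       ≡⟨ weight*Π⁻ ⟩
    Π⁺ y ys                                                     ≡⟨ identity y ⟩
    (1ℚ - two * T) * Π⁻ y ys + two * y * lagrangeSum y ys       ≡⟨ cong (λ s → (1ℚ - two * T) * Π⁻ y ys + two * y * s) lagrangeSum-y ⟩
    (1ℚ - two * T) * Π⁻ y ys + two * y * (V * Π⁻ y ys)          ≡⟨ collect T (Π⁻ y ys) y V ⟩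
    (1ℚ - two * T + two * y * V) * Π⁻ y ys                      ∎)
    where
    collect : ∀ T Π y V → (1ℚ - (1ℚ + 1ℚ) * T) * Π + (1ℚ + 1ℚ) * y * (V * Π) ≡ (1ℚ - (1ℚ + 1ℚ) * T + (1ℚ + 1ℚ) * y * V) * Π
    collect = solve-∀ ℚ-ring
    weight*Π⁻ : weight y ys * Π⁻ y ys ≡ Π⁺ y ys
    weight*Π⁻ = begin
      weight y ys * Π⁻ y ys                                     ≡⟨ sym (prod-* (factor y) (λ c → y - c) ys) ⟩
      prodℚ (map (λ c → factor y c * (y - c)) ys)               ≡⟨ prod-cong _ _ ys (λ c c∈ → ÷'-*-cancel (y + c) (y - c) (y-c≢0 c∈)) ⟩
      Π⁺ y ys                                                   ∎
    lagrangeSum-y : lagrangeSum y ys ≡ V * Π⁻ y ys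
    lagrangeSum-y = trans (sum-cong _ _ (selections ys) term) (sum-*ʳ (Π⁻ y ys) _ (selections ys))
      where
      term : ∀ s → s ∈ selections ys → weight (proj₁ s) (proj₂ s) * Π⁻ y (proj₂ s)
                                       ≡ weight (proj₁ s) (proj₂ s) * (y - proj₁ s) ⁻¹ * Π⁻ y ys
      term (b , cs) s∈ = begin
        w * Π⁻ y cs                              ≡⟨ cong (w *_) (sym (trans (cong (_* Π⁻ y cs) (*-inverseˡ′ (y - b) (y-b≢0 s∈))) (ℚₚ.*-identityˡ _))) ⟩
        w * ((y - b) ⁻¹ * (y - b) * Π⁻ y cs)     ≡⟨ reassoc w ((y - b) ⁻¹) (y - b) (Π⁻ y cs) ⟩
        w * (y - b) ⁻¹ * ((y - b) * Π⁻ y cs)     ≡⟨ cong (w * (y - b) ⁻¹ *_) (sym (selection-Π⁻ ys s∈ y)) ⟩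
        w * (y - b) ⁻¹ * Π⁻ y ys                 ∎
        where
        w = weight b cs
        reassoc : ∀ w i d p → w * (i * d * p) ≡ w * i * (d * p)
        reassoc = solve-∀ ℚ-ring

  factor-b-y : ∀ {b cs} → (b , cs) ∈ selections ys → factor b y ≡ 1ℚ - two * y * (y - b) ⁻¹
  factor-b-y {b} s∈ = *-cancelʳ-≢0 _ _ (b - y) b-y≢0 (begin
    factor b y * (b - y)                      ≡⟨ ÷'-*-cancel (b + y) (b - y) b-y≢0 ⟩
    b + y                                     ≡⟨ expand b y ⟩
    (b - y) + two * y * 1ℚ                    ≡⟨ cong (λ u → (b - y) + two * y * u) (sym (*-inverseʳ′ (y - b) (y-b≢0 s∈))) ⟩
    (b - y) + two * y * ((y - b) * q)         ≡⟨ collect b y q ⟩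
    (1ℚ - two * y * q) * (b - y)              ∎)
    where
    q = (y - b) ⁻¹
    b-y≢0 : b - y ≢ 0ℚ
    b-y≢0 b-y≡0 = y-b≢0 s∈ (subst (λ c → y - c ≡ 0ℚ) (sym (p-q≡0⇒p≡q b y b-y≡0)) (ℚₚ.+-inverseʳ y))
    expand : ∀ b y → b + y ≡ (b - y) + (1ℚ + 1ℚ) * y * 1ℚ
    expand = solve-∀ ℚ-ring
    collect : ∀ b y q → (b - y) + (1ℚ + 1ℚ) * y * ((y - b) * q) ≡ (1ℚ - (1ℚ + 1ℚ) * y * q) * (b - y)
    collect = solve-∀ ℚ-ring

  shifted-weightSum : sumℚ (map (λ (b , cs) → factor b y * weight b cs) (selections ys)) ≡ T - two * y * V
  shifted-weightSum = begin
    sumℚ (map (λ (b , cs) → factor b y * weight b cs) (selections ys))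
      ≡⟨ sum-cong _ _ (selections ys) (λ (b , cs) s∈ → trans (cong (_* weight b cs) (factor-b-y s∈)) (distrib (weight b cs) y ((y - b) ⁻¹))) ⟩
    sumℚ (map (λ (b , cs) → weight b cs - two * y * (weight b cs * (y - b) ⁻¹)) (selections ys))
      ≡⟨ sum-sub (uncurry weight) _ (selections ys) ⟩
    T - sumℚ (map (λ (b , cs) → two * y * (weight b cs * (y - b) ⁻¹)) (selections ys))
      ≡⟨ cong (λ s → T - s) (sum-*ˡ (two * y) _ (selections ys)) ⟩
    T - two * y * V ∎
    where
    distrib : ∀ w y q → (1ℚ - (1ℚ + 1ℚ) * y * q) * w ≡ w - (1ℚ + 1ℚ) * y * (w * q)
    distrib = solve-∀ ℚ-ring

  weightSum-∷ : weightSum (y ∷ ys) ≡ 1ℚ - T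
  weightSum-∷ = begin
    weight y ys + sumℚ (map (uncurry weight) (map (map₂ (y ∷_)) (selections ys)))
      ≡⟨ cong (weight y ys +_) (sum-map (uncurry weight) _ (selections ys)) ⟩
    weight y ys + sumℚ (map (λ (b , cs) → factor b y * weight b cs) (selections ys))
      ≡⟨ cong₂ _+_ weight-y shifted-weightSum ⟩
    1ℚ - two * T + two * y * V + (T - two * y * V)
      ≡⟨ cancel T y V ⟩
    1ℚ - T ∎
    where
    cancel : ∀ T y V → 1ℚ - (1ℚ + 1ℚ) * T + (1ℚ + 1ℚ) * y * V + (T - (1ℚ + 1ℚ) * y * V) ≡ 1ℚ - T
    cancel = solve-∀ ℚ-ring

  module _ (z : ℚ) where

    L : ℚ
    L = lagrangeSum z ys

    W : ℚ
    W = sumℚ (map (λ (b , cs) → weight b cs * (y - b) ⁻¹ * ((z - y) * Π⁻ z cs)) (selections ys))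

    W≡Π⁻*V-L : W ≡ Π⁻ z ys * V - L
    W≡Π⁻*V-L = begin
      W                    ≡⟨ add-sub W L ⟩
      (W + L) - L          ≡⟨ cong (_- L) (sym Π⁻*V) ⟩
      Π⁻ z ys * V - L      ∎
      where
      add-sub : ∀ a b → a ≡ (a + b) - b
      add-sub = solve-∀ ℚ-ring
      Π⁻*V : Π⁻ z ys * V ≡ W + L
      Π⁻*V = begin
        Π⁻ z ys * V
          ≡⟨ sym (sum-*ˡ (Π⁻ z ys) _ (selections ys)) ⟩
        sumℚ (map (λ (b , cs) → Π⁻ z ys * (weight b cs * (y - b) ⁻¹)) (selections ys))
          ≡⟨ sum-cong _ _ (selections ys) term ⟩
        sumℚ (map (λ (b , cs) → weight b cs * (y - b) ⁻¹ * ((z - y) * Π⁻ z cs) + weight b cs * Π⁻ z cs) (selections ys))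
          ≡⟨ sum-+ _ _ (selections ys) ⟩
        W + L ∎
        where
        term : ∀ s → s ∈ selections ys →
               Π⁻ z ys * (weight (proj₁ s) (proj₂ s) * (y - proj₁ s) ⁻¹)
               ≡ weight (proj₁ s) (proj₂ s) * (y - proj₁ s) ⁻¹ * ((z - y) * Π⁻ z (proj₂ s)) + weight (proj₁ s) (proj₂ s) * Π⁻ z (proj₂ s)
        term (b , cs) s∈ = begin
          Π⁻ z ys * (w * q)                               ≡⟨ cong (_* (w * q)) (selection-Π⁻ ys s∈ z) ⟩
          (z - b) * P * (w * q)                           ≡⟨ split-z-b b z y P w q ⟩
          w * q * ((z - y) * P) + w * P * ((y - b) * q)   ≡⟨ cong (λ u → w * q * ((z - y) * P) + w * P * u) (*-inverseʳ′ (y - b) (y-b≢0 s∈)) ⟩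
          w * q * ((z - y) * P) + w * P * 1ℚ              ≡⟨ cong (w * q * ((z - y) * P) +_) (ℚₚ.*-identityʳ _) ⟩
          w * q * ((z - y) * P) + w * P                   ∎
          where
          w = weight b cs
          q = (y - b) ⁻¹
          P = Π⁻ z cs
          split-z-b : ∀ b z y P w q → (z - b) * P * (w * q) ≡ w * q * ((z - y) * P) + w * P * ((y - b) * q)
          split-z-b = solve-∀ ℚ-ring

    shifted-lagrangeSum :
      sumℚ (map (λ (b , cs) → factor b y * weight b cs * ((z - y) * Π⁻ z cs)) (selections ys)) ≡ (z - y) * L - two * y * W
    shifted-lagrangeSum = begin
      sumℚ (map (λ (b , cs) → factor b y * weight b cs * ((z - y) * Π⁻ z cs)) (selections ys))
        ≡⟨ sum-cong _ _ (selections ys) (λ (b , cs) s∈ →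
             trans (cong (λ f → f * weight b cs * ((z - y) * Π⁻ z cs)) (factor-b-y s∈))
                   (distrib (weight b cs) y ((y - b) ⁻¹) z (Π⁻ z cs))) ⟩
      sumℚ (map (λ (b , cs) → (z - y) * (weight b cs * Π⁻ z cs) - two * y * (weight b cs * (y - b) ⁻¹ * ((z - y) * Π⁻ z cs)))
                (selections ys))
        ≡⟨ sum-sub _ _ (selections ys) ⟩
      sumℚ (map (λ (b , cs) → (z - y) * (weight b cs * Π⁻ z cs)) (selections ys))
        - sumℚ (map (λ (b , cs) → two * y * (weight b cs * (y - b) ⁻¹ * ((z - y) * Π⁻ z cs))) (selections ys))
        ≡⟨ cong₂ _-_ (sum-*ˡ (z - y) _ (selections ys)) (sum-*ˡ (two * y) _ (selections ys)) ⟩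
      (z - y) * L - two * y * W ∎
      where
      distrib : ∀ w y q z P → (1ℚ - (1ℚ + 1ℚ) * y * q) * w * ((z - y) * P)
                              ≡ (z - y) * (w * P) - (1ℚ + 1ℚ) * y * (w * q * ((z - y) * P))
      distrib = solve-∀ ℚ-ring

    identity-∷ : Π⁺ z (y ∷ ys) ≡ (1ℚ - two * weightSum (y ∷ ys)) * Π⁻ z (y ∷ ys) + two * z * lagrangeSum z (y ∷ ys)
    identity-∷ = begin
      (z + y) * Π⁺ z ys
        ≡⟨ cong ((z + y) *_) (identity z) ⟩
      (z + y) * ((1ℚ - two * T) * Π + two * z * L)
        ≡⟨ expand z y T Π V L ⟩
      (1ℚ - two * (1ℚ - T)) * ((z - y) * Π)
        + two * z * ((1ℚ - two * T + two * y * V) * Π + ((z - y) * L - two * y * (Π * V - L)))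
        ≡⟨ cong₂ (λ u v → (1ℚ - two * u) * ((z - y) * Π) + two * z * v)
                 (sym weightSum-∷)
                 (cong₂ _+_ (cong (_* Π) (sym weight-y))
                            (sym (trans shifted-lagrangeSum (cong (λ w → (z - y) * L - two * y * w) W≡Π⁻*V-L)))) ⟩
      (1ℚ - two * weightSum (y ∷ ys)) * Π⁻ z (y ∷ ys)
        + two * z * (weight y ys * Π + sumℚ (map (λ (b , cs) → factor b y * weight b cs * ((z - y) * Π⁻ z cs)) (selections ys)))
        ≡⟨ cong (λ s → (1ℚ - two * weightSum (y ∷ ys)) * Π⁻ z (y ∷ ys) + two * z * (weight y ys * Π + s))
                (sym (sum-map (λ (b , cs) → weight b cs * Π⁻ z cs) (map₂ (y ∷_)) (selections ys))) ⟩
      (1ℚ - two * weightSum (y ∷ ys)) * Π⁻ z (y ∷ ys) + two * z * lagrangeSum z (y ∷ ys) ∎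
      where
      Π = Π⁻ z ys
      expand : ∀ z y T Π V L →
        (z + y) * ((1ℚ - (1ℚ + 1ℚ) * T) * Π + (1ℚ + 1ℚ) * z * L)
        ≡ (1ℚ - (1ℚ + 1ℚ) * (1ℚ - T)) * ((z - y) * Π)
          + (1ℚ + 1ℚ) * z * ((1ℚ - (1ℚ + 1ℚ) * T + (1ℚ + 1ℚ) * y * V) * Π + ((z - y) * L - (1ℚ + 1ℚ) * y * (Π * V - L)))
      expand = solve-∀ ℚ-ring

parity-identity : ∀ ys → Distinct ys → PlusMinusIdentity ys × weightSum ys ≡ parity (length ys)
parity-identity []       []             = (λ z → sym (simplify z)) , refl
  where
  simplify : ∀ z → (1ℚ - (1ℚ + 1ℚ) * 0ℚ) * 1ℚ + (1ℚ + 1ℚ) * z * 0ℚ ≡ 1ℚ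
  simplify = solve-∀ ℚ-ring
parity-identity (y ∷ ys) (y∉ys ∷ distinct) =
  identity-∷ , trans weightSum-∷ (cong (λ p → 1ℚ - p) weightSum≡parity)
  where
  open ParityStep y ys y∉ys (proj₁ (parity-identity ys distinct))
  weightSum≡parity = proj₂ (parity-identity ys distinct)

weightSum-parity : ∀ ys → Distinct ys → weightSum ys ≡ parity (length ys)
weightSum-parity ys distinct = proj₂ (parity-identity ys distinct)

parity-even : ∀ q → parity (q ℕ.* 2) ≡ 0ℚ
parity-even zero    = refl
parity-even (suc q) = trans (involutive (parity (q ℕ.* 2))) (parity-even q)
  where
  involutive : ∀ p → 1ℚ - (1ℚ - p) ≡ p
  involutive = solve-∀ ℚ-ring

selections-map : ∀ {A B : Set} (f : A → B) xs →
                 selections (map f xs) ≡ map (λ (b , cs) → f b , map f cs) (selections xs)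
selections-map f []       = refl
selections-map f (y ∷ ys) = cong ((f y , map f ys) ∷_) (begin
  map (map₂ (f y ∷_)) (selections (map f ys))                                ≡⟨ cong (map _) (selections-map f ys) ⟩
  map (map₂ (f y ∷_)) (map (λ (b , cs) → f b , map f cs) (selections ys))    ≡⟨ sym (map-∘ (selections ys)) ⟩
  map (λ (b , cs) → f b , f y ∷ map f cs) (selections ys)                    ≡⟨ map-∘ (selections ys) ⟩
  map (λ (b , cs) → f b , map f cs) (map (map₂ (y ∷_)) (selections ys))      ∎)

module Deletion {A : Set} (_≟_ : DecidableEquality A) where

  delete : A → List A → List A
  delete a = filter (λ c → ¬? (c ≟ a))

  ∈-delete⁺ : ∀ {a c xs} → c ∈ xs → c ≢ a → c ∈ delete a xs
  ∈-delete⁺ = ∈-filter⁺ (λ c → ¬? (c ≟ _))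

  ∈-delete⁻ : ∀ {a c} xs → c ∈ delete a xs → c ∈ xs × c ≢ a
  ∈-delete⁻ xs = ∈-filter⁻ (λ c → ¬? (c ≟ _)) {xs = xs}

  delete-∉ : ∀ {a xs} → a ∉ xs → delete a xs ≡ xs
  delete-∉ {a} {xs} a∉xs = filter-all (λ c → ¬? (c ≟ a)) (All.tabulate (λ c∈ c≡a → a∉xs (subst (_∈ xs) c≡a c∈)))

  delete-head : ∀ {a xs} → Unique (a ∷ xs) → delete a (a ∷ xs) ≡ xs
  delete-head {a} u = trans (filter-reject (λ c → ¬? (c ≟ a)) (λ a≢a → a≢a refl)) (delete-∉ (Uniqueₚ.Unique[x∷xs]⇒x∉xs u))

  delete-≢ : ∀ {a c} xs → c ≢ a → delete a (c ∷ xs) ≡ c ∷ delete a xs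
  delete-≢ xs = filter-accept (λ c → ¬? (c ≟ _))

  delete-unique : ∀ a {xs} → Unique xs → Unique (delete a xs)
  delete-unique a = Uniqueₚ.filter⁺ (λ c → ¬? (c ≟ a))

  delete-comm : ∀ a b xs → delete a (delete b xs) ≡ delete b (delete a xs)
  delete-comm a b []       = refl
  delete-comm a b (c ∷ xs) with c ≟ b | c ≟ a
  ... | yes refl | yes refl = delete-comm a b xs
  ... | yes refl | no _     = trans (delete-comm a b xs) (sym (filter-reject (λ c → ¬? (c ≟ b)) (λ c≢c → c≢c refl)))
  ... | no _     | yes refl = trans (filter-reject (λ c → ¬? (c ≟ a)) (λ c≢c → c≢c refl)) (delete-comm a b xs)
  ... | no c≢b   | no c≢a   = trans (delete-≢ (delete b xs) c≢a)
                                    (trans (cong (c ∷_) (delete-comm a b xs)) (sym (delete-≢ (delete a xs) c≢b)))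

  length-delete : ∀ {a xs} → Unique xs → a ∈ xs → suc (length (delete a xs)) ≡ length xs
  length-delete u@(_ ∷ _) (here refl) = cong (suc ∘ length) (delete-head u)
  length-delete {a} {c ∷ xs} c∷u@(_ ∷ u) (there a∈) with c ≟ a
  ... | yes refl = ⊥-elim (Uniqueₚ.Unique[x∷xs]⇒x∉xs c∷u a∈)
  ... | no _     = cong suc (length-delete u a∈)

  sum-delete : ∀ (f : A → ℚ) {a xs} → Unique xs → a ∈ xs → sumℚ (map f xs) ≡ f a + sumℚ (map f (delete a xs))
  sum-delete f u@(_ ∷ _) (here refl) = cong (λ ys → f _ + sumℚ (map f ys)) (sym (delete-head u))
  sum-delete f {a} {c ∷ xs} c∷u@(_ ∷ u) (there a∈) with c ≟ a
  ... | yes refl = ⊥-elim (Uniqueₚ.Unique[x∷xs]⇒x∉xs c∷u a∈)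
  ... | no _     = trans (cong (f c +_) (sum-delete f u a∈)) (swap (f c) (f a) _)
    where
    swap : ∀ a b c → a + (b + c) ≡ b + (a + c)
    swap = solve-∀ ℚ-ring

  prod-delete : ∀ (f : A → ℚ) {a xs} → Unique xs → a ∈ xs → prodℚ (map f xs) ≡ f a * prodℚ (map f (delete a xs))
  prod-delete f u@(_ ∷ _) (here refl) = cong (λ ys → f _ * prodℚ (map f ys)) (sym (delete-head u))
  prod-delete f {a} {c ∷ xs} c∷u@(_ ∷ u) (there a∈) with c ≟ a
  ... | yes refl = ⊥-elim (Uniqueₚ.Unique[x∷xs]⇒x∉xs c∷u a∈)
  ... | no _     = trans (cong (f c *_) (prod-delete f u a∈)) (swap (f c) (f a) _)
    where
    swap : ∀ a b c → a * (b * c) ≡ b * (a * c)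
    swap = solve-∀ ℚ-ring

  prod-unique-cong : ∀ (f : A → ℚ) {xs ys} → Unique xs → Unique ys →
                     (∀ {c} → c ∈ xs → c ∈ ys) → (∀ {c} → c ∈ ys → c ∈ xs) → prodℚ (map f xs) ≡ prodℚ (map f ys)
  prod-unique-cong f {[]}     {[]}     _ _ _ _ = refl
  prod-unique-cong f {[]}     {c ∷ ys} _ _ _ ys⊆xs with ys⊆xs (here refl)
  ... | ()
  prod-unique-cong f {a ∷ xs} {ys} a∷u@(_ ∷ u) v xs⊆ys ys⊆xs = begin
    f a * prodℚ (map f xs)              ≡⟨ cong (f a *_) (prod-unique-cong f u (delete-unique a v) xs⊆ys-a ys-a⊆xs) ⟩
    f a * prodℚ (map f (delete a ys))   ≡⟨ sym (prod-delete f v (xs⊆ys (here refl))) ⟩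
    prodℚ (map f ys)                    ∎
    where
    xs⊆ys-a : ∀ {c} → c ∈ xs → c ∈ delete a ys
    xs⊆ys-a c∈ = ∈-delete⁺ (xs⊆ys (there c∈)) (λ c≡a → Uniqueₚ.Unique[x∷xs]⇒x∉xs a∷u (subst (_∈ xs) c≡a c∈))
    ys-a⊆xs : ∀ {c} → c ∈ delete a ys → c ∈ xs
    ys-a⊆xs c∈ with ∈-delete⁻ ys c∈
    ... | c∈ys , c≢a with ys⊆xs c∈ys
    ...   | here c≡a = ⊥-elim (c≢a c≡a)
    ...   | there c∈xs = c∈xs

  sum-delete-selections : ∀ (G : A → List A → ℚ) {xs} → Unique xs →
    sumℚ (map (λ a → G a (delete a xs)) xs) ≡ sumℚ (map (λ (b , cs) → G b cs) (selections xs))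
  sum-delete-selections G {[]}     _ = refl
  sum-delete-selections G {y ∷ ys} y∷u@(_ ∷ u) = cong₂ _+_ (cong (G y) (delete-head y∷u)) (begin
    sumℚ (map (λ a → G a (delete a (y ∷ ys))) ys)
      ≡⟨ sum-cong _ _ ys (λ a a∈ → cong (G a) (delete-≢ ys (λ y≡a → Uniqueₚ.Unique[x∷xs]⇒x∉xs y∷u (subst (_∈ ys) (sym y≡a) a∈)))) ⟩
    sumℚ (map (λ a → G a (y ∷ delete a ys)) ys)
      ≡⟨ sum-delete-selections (λ a cs → G a (y ∷ cs)) u ⟩
    sumℚ (map (λ (b , cs) → G b (y ∷ cs)) (selections ys))
      ≡⟨ sym (sum-map (λ (b , cs) → G b cs) (map₂ (y ∷_)) (selections ys)) ⟩
    sumℚ (map (λ (b , cs) → G b cs) (map (map₂ (y ∷_)) (selections ys))) ∎)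

-- One- and two-row sums over distinct points

module TwoRows (n : ℕ) (x : Fin (suc n) → ℚ) (x-injective : ∀ i j → x i ≡ x j → i ≡ j) (n-odd : parity n ≡ 1ℚ) where

  N = suc n
  I = allFin N

  open Deletion (Finₚ._≟_ {N}) public

  w₁ : Fin N → ℚ
  w₁ a = prodℚ (map (λ c → factor (x a) (x c)) (delete a I))

  w₂ : Fin N → Fin N → ℚ
  w₂ a b = prodℚ (map (λ c → factor (x b) (x c)) (delete b (delete a I)))

  S₁ : (ℚ → ℚ) → ℚ
  S₁ φ = sumℚ (map (λ a → φ (x a) * w₁ a) I)

  pairSum : (Fin N → Fin N → ℚ) → ℚ
  pairSum F = sumℚ (map (λ a → sumℚ (map (F a) (delete a I))) I)

  S₂ : (ℚ → ℚ) → (ℚ → ℚ) → ℚ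
  S₂ φ ψ = pairSum (λ a b → φ (x a) * ψ (x b) * (w₁ a * w₂ a b))

  I-unique : Unique I
  I-unique = Uniqueₚ.allFin⁺ N

  weightSum-delete : ∀ {is} → Unique is →
    sumℚ (map (λ a → prodℚ (map (λ c → factor (x a) (x c)) (delete a is))) is) ≡ parity (length is)
  weightSum-delete {is} u = begin
    sumℚ (map (λ a → prodℚ (map (λ c → factor (x a) (x c)) (delete a is))) is)
      ≡⟨ sum-delete-selections (λ a cs → prodℚ (map (λ c → factor (x a) (x c)) cs)) u ⟩
    sumℚ (map (λ (a , cs) → prodℚ (map (λ c → factor (x a) (x c)) cs)) (selections is))
      ≡⟨ sum-ext _ _ (selections is) (λ (a , cs) → sym (prod-map (factor (x a)) x cs)) ⟩
    sumℚ (map (λ (a , cs) → weight (x a) (map x cs)) (selections is))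
      ≡⟨ sym (sum-map (λ (b , cs) → weight b cs) _ (selections is)) ⟩
    sumℚ (map (λ (b , cs) → weight b cs) (map (λ (a , cs) → x a , map x cs) (selections is)))
      ≡⟨ cong (λ ss → sumℚ (map (λ (b , cs) → weight b cs) ss)) (sym (selections-map x is)) ⟩
    weightSum (map x is)
      ≡⟨ weightSum-parity (map x is) (AllPairsₚ.map⁺ (AllPairs.map (λ i≢j xi≡xj → i≢j (x-injective _ _ xi≡xj)) u)) ⟩
    parity (length (map x is))
      ≡⟨ cong parity (length-map x is) ⟩
    parity (length is) ∎

  S₁-1 : S₁ (λ _ → 1ℚ) ≡ 0ℚ
  S₁-1 = begin
    sumℚ (map (λ a → 1ℚ * w₁ a) I)   ≡⟨ sum-ext _ _ I (λ a → ℚₚ.*-identityˡ (w₁ a)) ⟩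
    sumℚ (map w₁ I)                  ≡⟨ weightSum-delete I-unique ⟩
    parity (length I)                ≡⟨ cong parity (length-tabulate {n = N} (λ i → i)) ⟩
    1ℚ - parity n                    ≡⟨ cong (λ p → 1ℚ - p) n-odd ⟩
    0ℚ                               ∎

  sum-w₂ : ∀ a → sumℚ (map (w₂ a) (delete a I)) ≡ 1ℚ
  sum-w₂ a = begin
    sumℚ (map (w₂ a) (delete a I))  ≡⟨ weightSum-delete (delete-unique a I-unique) ⟩
    parity (length (delete a I))    ≡⟨ cong parity (ℕₚ.suc-injective (trans (length-delete I-unique (∈-allFin a)) (length-tabulate {n = N} (λ i → i)))) ⟩
    parity n                        ≡⟨ n-odd ⟩
    1ℚ                              ∎

  -- w₁ b = factor (x b) (x a) * w₂ a b, and factor (x b) (x a) * (x b - x a) = x b + x a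
  w₁w₂-symmetry : ∀ a {b} → b ∈ delete a I → w₁ a * w₂ a b * (x a + x b) ≡ w₁ a * w₁ b * (x b - x a)
  w₁w₂-symmetry a {b} b∈ = sym (begin
    w₁ a * w₁ b * (x b - x a)                                ≡⟨ cong (λ w → w₁ a * w * (x b - x a)) w₁b ⟩
    w₁ a * (factor (x b) (x a) * w₂ a b) * (x b - x a)       ≡⟨ reorder (w₁ a) (factor (x b) (x a)) (w₂ a b) (x b - x a) ⟩
    w₁ a * w₂ a b * (factor (x b) (x a) * (x b - x a))       ≡⟨ cong (w₁ a * w₂ a b *_) (÷'-*-cancel (x b + x a) (x b - x a) xb-xa≢0) ⟩
    w₁ a * w₂ a b * (x b + x a)                              ≡⟨ cong (w₁ a * w₂ a b *_) (ℚₚ.+-comm (x b) (x a)) ⟩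
    w₁ a * w₂ a b * (x a + x b)                              ∎)
    where
    b≢a = proj₂ (∈-delete⁻ I b∈)
    reorder : ∀ p d q e → p * (d * q) * e ≡ p * q * (d * e)
    reorder = solve-∀ ℚ-ring
    xb-xa≢0 : x b - x a ≢ 0ℚ
    xb-xa≢0 xb-xa≡0 = b≢a (x-injective b a (p-q≡0⇒p≡q _ _ xb-xa≡0))
    w₁b : w₁ b ≡ factor (x b) (x a) * w₂ a b
    w₁b = trans (prod-delete (λ c → factor (x b) (x c)) (delete-unique b I-unique) (∈-delete⁺ (∈-allFin a) (λ a≡b → b≢a (sym a≡b))))
                (cong (λ cs → factor (x b) (x a) * prodℚ (map (λ c → factor (x b) (x c)) cs)) (delete-comm a b I))

  pairSum-cong : ∀ F G → (∀ a {b} → b ∈ delete a I → F a b ≡ G a b) → pairSum F ≡ pairSum G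
  pairSum-cong F G F≡G = sum-ext _ _ I (λ a → sum-cong (F a) (G a) (delete a I) (λ b → F≡G a))

  pairSum-lin : ∀ F G c → pairSum (λ a b → F a b + c * G a b) ≡ pairSum F + c * pairSum G
  pairSum-lin F G c = begin
    pairSum (λ a b → F a b + c * G a b)
      ≡⟨ sum-ext _ _ I (λ a → trans (sum-+ (F a) (λ b → c * G a b) (delete a I)) (cong (ΣF a +_) (sum-*ˡ c (G a) (delete a I)))) ⟩
    sumℚ (map (λ a → ΣF a + c * ΣG a) I)
      ≡⟨ sum-+ ΣF (λ a → c * ΣG a) I ⟩
    pairSum F + sumℚ (map (λ a → c * ΣG a) I)
      ≡⟨ cong (pairSum F +_) (sum-*ˡ c ΣG I) ⟩
    pairSum F + c * pairSum G ∎
    where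
    ΣF ΣG : Fin N → ℚ
    ΣF a = sumℚ (map (F a) (delete a I))
    ΣG a = sumℚ (map (G a) (delete a I))

  pairSum-complete : ∀ F → (∀ a → F a a ≡ 0ℚ) → pairSum F ≡ sumℚ (map (λ a → sumℚ (map (F a) I)) I)
  pairSum-complete F Faa≡0 = sum-ext _ _ I (λ a → sym (begin
    sumℚ (map (F a) I)                           ≡⟨ sum-delete (F a) I-unique (∈-allFin a) ⟩
    F a a + sumℚ (map (F a) (delete a I))        ≡⟨ cong (_+ sumℚ (map (F a) (delete a I))) (Faa≡0 a) ⟩
    0ℚ + sumℚ (map (F a) (delete a I))           ≡⟨ ℚₚ.+-identityˡ _ ⟩
    sumℚ (map (F a) (delete a I))                ∎))

  S₁-cong : ∀ φ ψ → (∀ y → φ y ≡ ψ y) → S₁ φ ≡ S₁ ψ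
  S₁-cong φ ψ φ≡ψ = sum-ext _ _ I (λ a → cong (_* w₁ a) (φ≡ψ (x a)))

  S₁-+ : ∀ φ ψ → S₁ (λ y → φ y + ψ y) ≡ S₁ φ + S₁ ψ
  S₁-+ φ ψ = trans (sum-ext _ _ I (λ a → ℚₚ.*-distribʳ-+ (w₁ a) (φ (x a)) (ψ (x a))))
                   (sum-+ (λ a → φ (x a) * w₁ a) (λ a → ψ (x a) * w₁ a) I)

  S₁-*ˡ : ∀ c φ → S₁ (λ y → c * φ y) ≡ c * S₁ φ
  S₁-*ˡ c φ = trans (sum-ext _ _ I (λ a → ℚₚ.*-assoc c (φ (x a)) (w₁ a))) (sum-*ˡ c _ I)

  S₁-lin : ∀ φ ψ c → S₁ (λ y → φ y + c * ψ y) ≡ S₁ φ + c * S₁ ψ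
  S₁-lin φ ψ c = trans (S₁-+ φ (λ y → c * ψ y)) (cong (S₁ φ +_) (S₁-*ˡ c ψ))

  S₂-cong : ∀ φ φ′ ψ ψ′ → (∀ y → φ y ≡ φ′ y) → (∀ y → ψ y ≡ ψ′ y) → S₂ φ ψ ≡ S₂ φ′ ψ′
  S₂-cong φ φ′ ψ ψ′ φ≡φ′ ψ≡ψ′ =
    pairSum-cong _ _ (λ a {b} _ → cong₂ (λ u v → u * v * (w₁ a * w₂ a b)) (φ≡φ′ (x a)) (ψ≡ψ′ (x b)))

  S₂-linˡ : ∀ φ φ′ ψ c → S₂ (λ y → φ y + c * φ′ y) ψ ≡ S₂ φ ψ + c * S₂ φ′ ψ
  S₂-linˡ φ φ′ ψ c =
    trans (pairSum-cong _ _ (λ a {b} _ → distrib (φ (x a)) c (φ′ (x a)) (ψ (x b)) (w₁ a * w₂ a b)))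
          (pairSum-lin (λ a b → φ (x a) * ψ (x b) * (w₁ a * w₂ a b)) (λ a b → φ′ (x a) * ψ (x b) * (w₁ a * w₂ a b)) c)
    where
    distrib : ∀ p c q r w → (p + c * q) * r * w ≡ p * r * w + c * (q * r * w)
    distrib = solve-∀ ℚ-ring

  S₂-linʳ : ∀ φ ψ ψ′ c → S₂ φ (λ y → ψ y + c * ψ′ y) ≡ S₂ φ ψ + c * S₂ φ ψ′
  S₂-linʳ φ ψ ψ′ c =
    trans (pairSum-cong _ _ (λ a {b} _ → distrib (φ (x a)) c (ψ (x b)) (ψ′ (x b)) (w₁ a * w₂ a b)))
          (pairSum-lin (λ a b → φ (x a) * ψ (x b) * (w₁ a * w₂ a b)) (λ a b → φ (x a) * ψ′ (x b) * (w₁ a * w₂ a b)) c)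
    where
    distrib : ∀ p c q r w → p * (q + c * r) * w ≡ p * q * w + c * (p * r * w)
    distrib = solve-∀ ℚ-ring

  S₂-1 : ∀ φ → S₂ φ (λ _ → 1ℚ) ≡ S₁ φ
  S₂-1 φ = sum-ext _ _ I (λ a → begin
    sumℚ (map (λ b → φ (x a) * 1ℚ * (w₁ a * w₂ a b)) (delete a I))   ≡⟨ sum-ext _ _ (delete a I) (λ b → reassoc (φ (x a)) (w₁ a) (w₂ a b)) ⟩
    sumℚ (map (λ b → φ (x a) * w₁ a * w₂ a b) (delete a I))          ≡⟨ sum-*ˡ (φ (x a) * w₁ a) (w₂ a) (delete a I) ⟩
    φ (x a) * w₁ a * sumℚ (map (w₂ a) (delete a I))                  ≡⟨ cong (φ (x a) * w₁ a *_) (sum-w₂ a) ⟩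
    φ (x a) * w₁ a * 1ℚ                                              ≡⟨ ℚₚ.*-identityʳ _ ⟩
    φ (x a) * w₁ a                                                   ∎)
    where
    reassoc : ∀ p q r → p * 1ℚ * (q * r) ≡ p * q * r
    reassoc = solve-∀ ℚ-ring

  skew : (ℚ → ℚ) → (ℚ → ℚ) → Fin N → Fin N → ℚ
  skew φ ψ a b = φ (x a) * ψ (x b) * (w₁ a * w₁ b) * (x b - x a)

  S₂-shift-skew : ∀ φ ψ → S₂ (λ y → y * φ y) ψ + S₂ φ (λ y → y * ψ y) ≡ pairSum (skew φ ψ)
  S₂-shift-skew φ ψ = begin
    S₂ yφ ψ + S₂ φ yψ               ≡⟨ cong (S₂ yφ ψ +_) (sym (ℚₚ.*-identityˡ _)) ⟩
    S₂ yφ ψ + 1ℚ * S₂ φ yψ          ≡⟨ sym (pairSum-lin (λ a b → yφ (x a) * ψ (x b) * (w₁ a * w₂ a b))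
                                                        (λ a b → φ (x a) * yψ (x b) * (w₁ a * w₂ a b)) 1ℚ) ⟩
    pairSum (λ a b → yφ (x a) * ψ (x b) * (w₁ a * w₂ a b) + 1ℚ * (φ (x a) * yψ (x b) * (w₁ a * w₂ a b)))
                                    ≡⟨ pairSum-cong _ _ combine ⟩
    pairSum (skew φ ψ)              ∎
    where
    yφ yψ : ℚ → ℚ
    yφ y = y * φ y
    yψ y = y * ψ y
    combine : ∀ a {b} → b ∈ delete a I →
              yφ (x a) * ψ (x b) * (w₁ a * w₂ a b) + 1ℚ * (φ (x a) * yψ (x b) * (w₁ a * w₂ a b)) ≡ skew φ ψ a b
    combine a {b} b∈ = begin
      x a * φ (x a) * ψ (x b) * (w₁ a * w₂ a b) + 1ℚ * (φ (x a) * (x b * ψ (x b)) * (w₁ a * w₂ a b))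
        ≡⟨ collect (x a) (x b) (φ (x a)) (ψ (x b)) (w₁ a) (w₂ a b) ⟩
      φ (x a) * ψ (x b) * (w₁ a * w₂ a b * (x a + x b))
        ≡⟨ cong (φ (x a) * ψ (x b) *_) (w₁w₂-symmetry a b∈) ⟩
      φ (x a) * ψ (x b) * (w₁ a * w₁ b * (x b - x a))
        ≡⟨ sym (ℚₚ.*-assoc (φ (x a) * ψ (x b)) _ _) ⟩
      skew φ ψ a b ∎
      where
      collect : ∀ xa xb p q u v → xa * p * q * (u * v) + 1ℚ * (p * (xb * q) * (u * v)) ≡ p * q * (u * v * (xa + xb))
      collect = solve-∀ ℚ-ring

  sum-skew : ∀ φ ψ → sumℚ (map (λ a → sumℚ (map (skew φ ψ a) I)) I) ≡ S₁ φ * S₁ (λ y → y * ψ y) - S₁ (λ y → y * φ y) * S₁ ψ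
  sum-skew φ ψ = begin
    sumℚ (map (λ a → sumℚ (map (skew φ ψ a) I)) I)
      ≡⟨ sum-ext _ _ I row ⟩
    sumℚ (map (λ a → φ (x a) * w₁ a * S₁ yψ - yφ (x a) * w₁ a * S₁ ψ) I)
      ≡⟨ sum-sub (λ a → φ (x a) * w₁ a * S₁ yψ) (λ a → yφ (x a) * w₁ a * S₁ ψ) I ⟩
    sumℚ (map (λ a → φ (x a) * w₁ a * S₁ yψ) I) - sumℚ (map (λ a → yφ (x a) * w₁ a * S₁ ψ) I)
      ≡⟨ cong₂ _-_ (sum-*ʳ (S₁ yψ) (λ a → φ (x a) * w₁ a) I) (sum-*ʳ (S₁ ψ) (λ a → yφ (x a) * w₁ a) I) ⟩
    S₁ φ * S₁ yψ - S₁ yφ * S₁ ψ ∎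
    where
    yφ yψ : ℚ → ℚ
    yφ y = y * φ y
    yψ y = y * ψ y
    row : ∀ a → sumℚ (map (skew φ ψ a) I) ≡ φ (x a) * w₁ a * S₁ yψ - yφ (x a) * w₁ a * S₁ ψ
    row a = begin
      sumℚ (map (skew φ ψ a) I)
        ≡⟨ sum-ext _ _ I (λ b → expand (φ (x a)) (ψ (x b)) (w₁ a) (w₁ b) (x a) (x b)) ⟩
      sumℚ (map (λ b → φ (x a) * w₁ a * (yψ (x b) * w₁ b) - yφ (x a) * w₁ a * (ψ (x b) * w₁ b)) I)
        ≡⟨ sum-sub (λ b → φ (x a) * w₁ a * (yψ (x b) * w₁ b)) (λ b → yφ (x a) * w₁ a * (ψ (x b) * w₁ b)) I ⟩
      sumℚ (map (λ b → φ (x a) * w₁ a * (yψ (x b) * w₁ b)) I) - sumℚ (map (λ b → yφ (x a) * w₁ a * (ψ (x b) * w₁ b)) I)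
        ≡⟨ cong₂ _-_ (sum-*ˡ (φ (x a) * w₁ a) _ I) (sum-*ˡ (yφ (x a) * w₁ a) _ I) ⟩
      φ (x a) * w₁ a * S₁ yψ - yφ (x a) * w₁ a * S₁ ψ ∎
      where
      expand : ∀ p q u v xa xb → p * q * (u * v) * (xb - xa) ≡ p * u * (xb * q * v) - xa * p * u * (q * v)
      expand = solve-∀ ℚ-ring

  S₂-shift : ∀ φ ψ → S₂ (λ y → y * φ y) ψ + S₂ φ (λ y → y * ψ y) ≡ S₁ φ * S₁ (λ y → y * ψ y) - S₁ (λ y → y * φ y) * S₁ ψ
  S₂-shift φ ψ = trans (S₂-shift-skew φ ψ) (trans (pairSum-complete (skew φ ψ) skew-diagonal) (sum-skew φ ψ))
    where
    skew-diagonal : ∀ a → skew φ ψ a a ≡ 0ℚ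
    skew-diagonal a = vanish (φ (x a)) (ψ (x a)) (w₁ a) (x a)
      where
      vanish : ∀ p q r y → p * q * (r * r) * (y - y) ≡ 0ℚ
      vanish = solve-∀ ℚ-ring

  S₁-Σ< : ∀ m (c : ℕ → ℚ) (F : ℕ → ℚ → ℚ) → S₁ (λ y → Σ< m (λ j → c j * F j y)) ≡ Σ< m (λ j → c j * S₁ (F j))
  S₁-Σ< zero    c F = sum-0 _ I (λ a _ → ℚₚ.*-zeroˡ (w₁ a))
  S₁-Σ< (suc m) c F = begin
    S₁ (λ y → c 0 * F 0 y + Σ< m (λ j → c (suc j) * F (suc j) y))
      ≡⟨ S₁-+ (λ y → c 0 * F 0 y) (λ y → Σ< m (λ j → c (suc j) * F (suc j) y)) ⟩
    S₁ (λ y → c 0 * F 0 y) + S₁ (λ y → Σ< m (λ j → c (suc j) * F (suc j) y))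
      ≡⟨ cong₂ _+_ (S₁-*ˡ (c 0) (F 0)) (S₁-Σ< m (c ∘ suc) (F ∘ suc)) ⟩
    c 0 * S₁ (F 0) + Σ< m (λ j → c (suc j) * S₁ (F (suc j))) ∎

module TwoRowRecursion (n : ℕ) (x : Fin (suc n) → ℚ) (x-injective : ∀ i j → x i ≡ x j → i ≡ j)
                       (n-odd : parity n ≡ 1ℚ) (t : ℕ → ℚ) where

  open TwoRows n x x-injective n-odd

  fp : ℕ → ℚ → ℚ
  fp l y = fpow t y l

  Πt⁺ : ℕ → ℕ → ℚ → ℚ
  Πt⁺ a b y = prodℚ (map (λ i → y + t i) (range a b))

  crossTerm : (ℚ → ℚ) → ℕ → ℕ → ℚ
  crossTerm φ l i = two * sgn (l ∸ suc i) * S₁ (λ y → y * Πt⁺ (suc (suc (suc i))) l y * φ y) * S₁ (fp (suc i))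

  crossTerms : (ℚ → ℚ) → ℕ → ℚ
  crossTerms φ l = Σ< (l ∸ 1) (crossTerm φ l)

  crossTerm-suc : ∀ l φ i → i < l →
    crossTerm φ (suc (suc l)) i ≡ - crossTerm (λ y → y * φ y + t (suc (suc l)) * φ y) (suc l) i
  crossTerm-suc l φ i i<l = begin
    two * sgn (suc l ∸ i) * S₁ (λ y → y * Πt⁺ (suc (suc (suc i))) (suc (suc l)) y * φ y) * S₁ (fp (suc i))
      ≡⟨ cong₂ (λ j s → two * sgn j * s * S₁ (fp (suc i))) (m∸n≡suc[m∸suc[n]] (suc l) i (s≤s (ℕₚ.<⇒≤ i<l))) peel ⟩
    two * (- sgn (l ∸ i)) * S₁ (λ y → y * Πt⁺ (suc (suc (suc i))) (suc l) y * φ′ y) * S₁ (fp (suc i))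
      ≡⟨ neg-out two (sgn (l ∸ i)) _ _ ⟩
    - crossTerm φ′ (suc l) i ∎
    where
    τ = t (suc (suc l))
    φ′ : ℚ → ℚ
    φ′ y = y * φ y + τ * φ y
    neg-out : ∀ a b c d → a * (- b) * c * d ≡ - (a * b * c * d)
    neg-out = solve-∀ ℚ-ring
    peel : S₁ (λ y → y * Πt⁺ (suc (suc (suc i))) (suc (suc l)) y * φ y) ≡ S₁ (λ y → y * Πt⁺ (suc (suc (suc i))) (suc l) y * φ′ y)
    peel = S₁-cong _ _ (λ y → trans (cong (λ p → y * p * φ y) (prod-range-snoc (λ j → y + t j) (suc (suc (suc i))) (suc l) (s≤s (s≤s i<l))))
                                    (distrib y (Πt⁺ (suc (suc (suc i))) (suc l) y) τ (φ y)))
      where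
      distrib : ∀ y v τ p → y * (v * (y + τ)) * p ≡ y * v * (y * p + τ * p)
      distrib = solve-∀ ℚ-ring

  crossTerm-last : ∀ l φ → crossTerm φ (suc (suc l)) l ≡ - (two * S₁ (λ y → y * φ y) * S₁ (fp (suc l)))
  crossTerm-last l φ = begin
    two * sgn (suc l ∸ l) * S₁ (λ y → y * Πt⁺ (suc (suc (suc l))) (suc (suc l)) y * φ y) * S₁ (fp (suc l))
      ≡⟨ cong₂ (λ j s → two * sgn j * s * S₁ (fp (suc l)))
               (trans (m∸n≡suc[m∸suc[n]] (suc l) l (ℕₚ.n<1+n l)) (cong suc (ℕₚ.n∸n≡0 l))) empty ⟩
    two * (- 1ℚ) * S₁ (λ y → y * φ y) * S₁ (fp (suc l))
      ≡⟨ neg-out two (S₁ (λ y → y * φ y)) (S₁ (fp (suc l))) ⟩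
    - (two * S₁ (λ y → y * φ y) * S₁ (fp (suc l))) ∎
    where
    neg-out : ∀ a c d → a * (- 1ℚ) * c * d ≡ - (a * c * d)
    neg-out = solve-∀ ℚ-ring
    empty : S₁ (λ y → y * Πt⁺ (suc (suc (suc l))) (suc (suc l)) y * φ y) ≡ S₁ (λ y → y * φ y)
    empty = S₁-cong _ _ (λ y → trans (cong (λ is → y * prodℚ (map (λ j → y + t j) is) * φ y) (range-empty (suc (suc l))))
                                     (cong (_* φ y) (ℚₚ.*-identityʳ y)))

  crossTerms-suc : ∀ l φ →
    crossTerms φ (suc l) ≡ - crossTerms (λ y → y * φ y + t (suc l) * φ y) l - two * S₁ (λ y → y * φ y) * S₁ (fp l)
  crossTerms-suc zero φ = begin
    0ℚ                                              ≡⟨ pad (S₁ (λ y → y * φ y)) ⟩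
    - 0ℚ - two * S₁ (λ y → y * φ y) * 0ℚ            ≡⟨ cong (λ s → - 0ℚ - two * S₁ (λ y → y * φ y) * s) (sym S₁-1) ⟩
    - 0ℚ - two * S₁ (λ y → y * φ y) * S₁ (fp 0)     ∎
    where
    pad : ∀ a → 0ℚ ≡ - 0ℚ - (1ℚ + 1ℚ) * a * 0ℚ
    pad = solve-∀ ℚ-ring
  crossTerms-suc (suc l) φ = begin
    Σ< (suc l) C                                  ≡⟨ Σ<-snoc l C ⟩
    Σ< l C + C l                                  ≡⟨ cong₂ _+_ (Σ<-cong l C (λ i → - C′ i) (crossTerm-suc l φ)) (crossTerm-last l φ) ⟩
    Σ< l (λ i → - C′ i) + - (two * S₁ (λ y → y * φ y) * S₁ (fp (suc l)))
                                                  ≡⟨ cong (_+ - (two * S₁ (λ y → y * φ y) * S₁ (fp (suc l)))) (Σ<-neg l C′) ⟩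
    - Σ< l C′ + - (two * S₁ (λ y → y * φ y) * S₁ (fp (suc l))) ∎
    where
    C C′ : ℕ → ℚ
    C = crossTerm φ (suc (suc l))
    C′ = crossTerm (λ y → y * φ y + t (suc (suc l)) * φ y) (suc l)

  fp-suc : ∀ l y → fp (suc l) y ≡ y * fp l y + (- t (suc l)) * fp l y
  fp-suc l y = trans (fpow-suc t y l) (distrib (fp l y) y (t (suc l)))
    where
    distrib : ∀ a y τ → a * (y - τ) ≡ y * a + (- τ) * a
    distrib = solve-∀ ℚ-ring

  S₁-fp-suc : ∀ l → S₁ (fp (suc l)) ≡ S₁ (λ y → y * fp l y) + (- t (suc l)) * S₁ (fp l)
  S₁-fp-suc l = trans (S₁-cong _ _ (fp-suc l)) (S₁-lin (λ y → y * fp l y) (fp l) (- t (suc l)))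

  S₁-Πt⁺-suc : ∀ l (φ : ℚ → ℚ) → S₁ (λ y → Πt⁺ 1 (suc l) y * φ y) ≡ S₁ (λ y → Πt⁺ 1 l y * (y * φ y + t (suc l) * φ y))
  S₁-Πt⁺-suc l φ =
    S₁-cong (λ y → Πt⁺ 1 (suc l) y * φ y) (λ y → Πt⁺ 1 l y * (y * φ y + t (suc l) * φ y))
            (λ y → trans (cong (_* φ y) (prod-range-snoc (λ i → y + t i) 1 l (s≤s z≤n))) (distrib (Πt⁺ 1 l y) y (t (suc l)) (φ y)))
    where
    distrib : ∀ u y τ p → u * (y + τ) * p ≡ u * (y * p + τ * p)
    distrib = solve-∀ ℚ-ring

  S₂-fp-suc : ∀ l φ → S₂ φ (fp (suc l))
              ≡ (S₁ φ * S₁ (λ y → y * fp l y) - S₁ (λ y → y * φ y) * S₁ (fp l)) - S₂ (λ y → y * φ y + t (suc l) * φ y) (fp l)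
  S₂-fp-suc l φ = begin
    S₂ φ (fp (suc l))                          ≡⟨ S₂-cong φ φ (fp (suc l)) _ (λ _ → refl) (fp-suc l) ⟩
    S₂ φ (λ y → yf y + (- τ) * fp l y)         ≡⟨ S₂-linʳ φ yf (fp l) (- τ) ⟩
    S₂ φ yf + (- τ) * S₂ φ (fp l)              ≡⟨ cong (_+ (- τ) * S₂ φ (fp l)) shift-right ⟩
    (D - S₂ yφ (fp l)) + (- τ) * S₂ φ (fp l)   ≡⟨ regroup D (S₂ yφ (fp l)) τ (S₂ φ (fp l)) ⟩
    D - (S₂ yφ (fp l) + τ * S₂ φ (fp l))       ≡⟨ cong (λ s → D - s) (sym (S₂-linˡ yφ φ (fp l) τ)) ⟩
    D - S₂ (λ y → yφ y + τ * φ y) (fp l)       ∎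
    where
    τ = t (suc l)
    yf yφ : ℚ → ℚ
    yf y = y * fp l y
    yφ y = y * φ y
    D = S₁ φ * S₁ yf - S₁ yφ * S₁ (fp l)
    shift-right : S₂ φ yf ≡ D - S₂ yφ (fp l)
    shift-right = trans (add-sub (S₂ yφ (fp l)) (S₂ φ yf)) (cong (_- S₂ yφ (fp l)) (S₂-shift φ (fp l)))
      where
      add-sub : ∀ u v → v ≡ (u + v) - u
      add-sub = solve-∀ ℚ-ring
    regroup : ∀ R b τ c → (R - b) + (- τ) * c ≡ R - (b + τ * c)
    regroup = solve-∀ ℚ-ring

  -- For φ = (y|t)^k the three summands are P_k P_l and the s = 0 and 0 < s < l parts of the correction sum.
  S₂-fpow : ∀ l φ → S₂ φ (fp l) ≡ S₁ φ * S₁ (fp l) + sgn l * S₁ (λ y → Πt⁺ 1 l y * φ y) + crossTerms φ l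
  S₂-fpow zero φ = begin
    S₂ φ (λ _ → 1ℚ)                                      ≡⟨ S₂-1 φ ⟩
    S₁ φ                                                 ≡⟨ pad (S₁ φ) ⟩
    S₁ φ * 0ℚ + 1ℚ * S₁ φ + 0ℚ
      ≡⟨ cong₂ (λ u v → S₁ φ * u + 1ℚ * v + 0ℚ) (sym S₁-1) (S₁-cong _ _ (λ y → sym (ℚₚ.*-identityˡ (φ y)))) ⟩
    S₁ φ * S₁ (fp 0) + 1ℚ * S₁ (λ y → 1ℚ * φ y) + 0ℚ     ∎
    where
    pad : ∀ a → a ≡ a * 0ℚ + 1ℚ * a + 0ℚ
    pad = solve-∀ ℚ-ring
  S₂-fpow (suc l) φ = begin
    S₂ φ (fp (suc l))
      ≡⟨ S₂-fp-suc l φ ⟩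
    D - S₂ φ′ (fp l)
      ≡⟨ cong (λ s → D - s) (S₂-fpow l φ′) ⟩
    D - (S₁ φ′ * S₁ (fp l) + sgn l * S₁ (λ y → Πt⁺ 1 l y * φ′ y) + crossTerms φ′ l)
      ≡⟨ cong (λ s → D - (s * S₁ (fp l) + sgn l * S₁ (λ y → Πt⁺ 1 l y * φ′ y) + crossTerms φ′ l)) (S₁-lin yφ φ τ) ⟩
    D - ((S₁ yφ + τ * S₁ φ) * S₁ (fp l) + sgn l * S₁ (λ y → Πt⁺ 1 l y * φ′ y) + crossTerms φ′ l)
      ≡⟨ collect (S₁ φ) (S₁ yf) (S₁ yφ) (S₁ (fp l)) τ (sgn l) (S₁ (λ y → Πt⁺ 1 l y * φ′ y)) (crossTerms φ′ l) ⟩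
    S₁ φ * (S₁ yf + (- τ) * S₁ (fp l)) + (- sgn l) * S₁ (λ y → Πt⁺ 1 l y * φ′ y)
      + (- crossTerms φ′ l - two * S₁ yφ * S₁ (fp l))
      ≡⟨ cong₂ (λ u v → S₁ φ * u + (- sgn l) * v + (- crossTerms φ′ l - two * S₁ yφ * S₁ (fp l)))
               (sym (S₁-fp-suc l)) (sym (S₁-Πt⁺-suc l φ)) ⟩
    S₁ φ * S₁ (fp (suc l)) + sgn (suc l) * S₁ (λ y → Πt⁺ 1 (suc l) y * φ y)
      + (- crossTerms φ′ l - two * S₁ yφ * S₁ (fp l))
      ≡⟨ cong (S₁ φ * S₁ (fp (suc l)) + sgn (suc l) * S₁ (λ y → Πt⁺ 1 (suc l) y * φ y) +_) (sym (crossTerms-suc l φ)) ⟩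
    S₁ φ * S₁ (fp (suc l)) + sgn (suc l) * S₁ (λ y → Πt⁺ 1 (suc l) y * φ y) + crossTerms φ (suc l) ∎
    where
    τ = t (suc l)
    yf yφ φ′ : ℚ → ℚ
    yf y = y * fp l y
    yφ y = y * φ y
    φ′ y = y * φ y + τ * φ y
    D = S₁ φ * S₁ yf - S₁ yφ * S₁ (fp l)
    collect : ∀ a bz cz d τ sg E C → (a * bz - cz * d) - ((cz + τ * a) * d + sg * E + C)
              ≡ a * (bz + (- τ) * d) + (- sg) * E + (- C - (1ℚ + 1ℚ) * cz * d)
    collect = solve-∀ ℚ-ring

-- Expansion in factorial powers

pow : ℚ → ℕ → ℚ
pow y zero    = 1ℚ
pow y (suc e) = y * pow y e

module FactorialExpansion (t : ℕ → ℚ) (y : ℚ) where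

  hcTerm : ℕ → ℕ → ℕ → ℚ
  hcTerm e k j = hc (e ∸ j) (tSeg t (suc k) (suc j)) * fpow t y (k ℕ.+ j)

  hhTerm : List ℚ → ℕ → ℕ → ℕ → ℚ
  hhTerm zs m k j = hh (m ∸ j) (tSeg t (suc k) (suc j)) zs * fpow t y (k ℕ.+ j)

  hcTerm-head : ∀ e k → t (suc k) * hcTerm e k 0 ≡ hcTerm (suc e) k 0
  hcTerm-head e k = begin
    a * (hc e (tSeg t (suc k) 1) * fpow t y (k ℕ.+ 0))     ≡⟨ cong (λ ts → a * (hc e ts * fpow t y (k ℕ.+ 0))) (tSeg-suc t (suc k) 0) ⟩
    a * (hc e (a ∷ []) * fpow t y (k ℕ.+ 0))               ≡⟨ reassoc (hc e (a ∷ [])) a _ ⟩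
    (0ℚ + a * hc e (a ∷ [])) * fpow t y (k ℕ.+ 0)          ≡⟨ cong (λ ts → hc (suc e) ts * fpow t y (k ℕ.+ 0)) (sym (tSeg-suc t (suc k) 0)) ⟩
    hcTerm (suc e) k 0                                     ∎
    where
    a = t (suc k)
    reassoc : ∀ h a f → a * (h * f) ≡ (0ℚ + a * h) * f
    reassoc = solve-∀ ℚ-ring

  hcTerm-top : ∀ e k → hcTerm e (suc k) e ≡ hcTerm (suc e) k (suc e)
  hcTerm-top e k = begin
    hc (e ∸ e) (tSeg t (suc (suc k)) (suc e)) * fpow t y (suc k ℕ.+ e)
      ≡⟨ cong₂ (λ i j → hc i (tSeg t (suc (suc k)) (suc e)) * fpow t y j) (ℕₚ.n∸n≡0 e) (sym (ℕₚ.+-suc k e)) ⟩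
    1ℚ * fpow t y (k ℕ.+ suc e)
      ≡⟨ cong (λ i → hc i (tSeg t (suc k) (suc (suc e))) * fpow t y (k ℕ.+ suc e)) (sym (ℕₚ.n∸n≡0 e)) ⟩
    hcTerm (suc e) k (suc e) ∎

  -- h_{i+1}(t_{k+1}, t_{k+2}, …) = h_{i+1}(t_{k+2}, …) + t_{k+1} h_i(t_{k+1}, t_{k+2}, …), applied to one term
  hcTerm-step : ∀ e k j → j < e → hcTerm (suc e) k (suc j) ≡ hcTerm e (suc k) j + t (suc k) * hcTerm e k (suc j)
  hcTerm-step e k j j<e = begin
    hc (e ∸ j) (tSeg t (suc k) (suc (suc j))) * fpow t y (k ℕ.+ suc j)
      ≡⟨ cong₂ (λ ts i → hc (e ∸ j) ts * fpow t y i) (tSeg-suc t (suc k) (suc j)) (ℕₚ.+-suc k j) ⟩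
    hc (e ∸ j) (a ∷ ts) * f
      ≡⟨ cong (λ i → hc i (a ∷ ts) * f) e∸j ⟩
    (hc (suc (e ∸ suc j)) ts + a * hc (e ∸ suc j) (a ∷ ts)) * f
      ≡⟨ distrib (hc (suc (e ∸ suc j)) ts) a (hc (e ∸ suc j) (a ∷ ts)) f ⟩
    hc (suc (e ∸ suc j)) ts * f + a * (hc (e ∸ suc j) (a ∷ ts) * f)
      ≡⟨ cong₂ (λ i ts′ → hc i ts * f + a * (hc (e ∸ suc j) ts′ * f)) (sym e∸j) (sym (tSeg-suc t (suc k) (suc j))) ⟩
    hcTerm e (suc k) j + a * (hc (e ∸ suc j) (tSeg t (suc k) (suc (suc j))) * f)
      ≡⟨ cong (λ i → hcTerm e (suc k) j + a * (hc (e ∸ suc j) (tSeg t (suc k) (suc (suc j))) * fpow t y i)) (sym (ℕₚ.+-suc k j)) ⟩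
    hcTerm e (suc k) j + a * hcTerm e k (suc j) ∎
    where
    a = t (suc k)
    ts = tSeg t (suc (suc k)) (suc j)
    f = fpow t y (suc k ℕ.+ j)
    e∸j = m∸n≡suc[m∸suc[n]] e j j<e
    distrib : ∀ h₁ a h₂ f → (h₁ + a * h₂) * f ≡ h₁ * f + a * (h₂ * f)
    distrib = solve-∀ ℚ-ring

  hcTerm-recombine : ∀ e k →
    Σ< (suc e) (hcTerm e (suc k)) + t (suc k) * Σ< (suc e) (hcTerm e k) ≡ Σ< (suc (suc e)) (hcTerm (suc e) k)
  hcTerm-recombine e k = begin
    Σ< (suc e) P + a * (Q 0 + Σ< e (Q ∘ suc))          ≡⟨ cong (_+ a * (Q 0 + Σ< e (Q ∘ suc))) (Σ<-snoc e P) ⟩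
    (Σ< e P + P e) + a * (Q 0 + Σ< e (Q ∘ suc))        ≡⟨ regroup (Σ< e P) (P e) a (Q 0) (Σ< e (Q ∘ suc)) ⟩
    a * Q 0 + ((Σ< e P + a * Σ< e (Q ∘ suc)) + P e)    ≡⟨ cong₂ (λ u v → u + (v + P e)) (hcTerm-head e k) (sym middle) ⟩
    R 0 + (Σ< e (R ∘ suc) + P e)                        ≡⟨ cong (λ v → R 0 + (Σ< e (R ∘ suc) + v)) (hcTerm-top e k) ⟩
    R 0 + (Σ< e (R ∘ suc) + R (suc e))                  ≡⟨ cong (R 0 +_) (sym (Σ<-snoc e (R ∘ suc))) ⟩
    Σ< (suc (suc e)) R                                  ∎
    where
    a = t (suc k)
    P Q R : ℕ → ℚ
    P = hcTerm e (suc k)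
    Q = hcTerm e k
    R = hcTerm (suc e) k
    regroup : ∀ sp pe a q0 sq → (sp + pe) + a * (q0 + sq) ≡ a * q0 + ((sp + a * sq) + pe)
    regroup = solve-∀ ℚ-ring
    middle : Σ< e (R ∘ suc) ≡ Σ< e P + a * Σ< e (Q ∘ suc)
    middle = begin
      Σ< e (R ∘ suc)                          ≡⟨ Σ<-cong e _ _ (hcTerm-step e k) ⟩
      Σ< e (λ j → P j + a * Q (suc j))        ≡⟨ Σ<-+ e _ _ ⟩
      Σ< e P + Σ< e (λ j → a * Q (suc j))     ≡⟨ cong (Σ< e P +_) (Σ<-*ˡ e a (Q ∘ suc)) ⟩
      Σ< e P + a * Σ< e (Q ∘ suc)             ∎

  pow-fpow-expansion : ∀ e k → pow y e * fpow t y k ≡ Σ< (suc e) (hcTerm e k)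
  pow-fpow-expansion zero k = begin
    1ℚ * fpow t y k                    ≡⟨ pad (fpow t y k) ⟩
    1ℚ * fpow t y k + 0ℚ               ≡⟨ cong (λ i → 1ℚ * fpow t y i + 0ℚ) (sym (ℕₚ.+-identityʳ k)) ⟩
    1ℚ * fpow t y (k ℕ.+ 0) + 0ℚ       ∎
    where
    pad : ∀ a → 1ℚ * a ≡ 1ℚ * a + 0ℚ
    pad = solve-∀ ℚ-ring
  pow-fpow-expansion (suc e) k = begin
    y * pow y e * fpow t y k                                          ≡⟨ trans (ℚₚ.*-assoc y (pow y e) _) (reorder y (pow y e) _) ⟩
    pow y e * (y * fpow t y k)                                        ≡⟨ cong (pow y e *_) (y*fpow t y k) ⟩
    pow y e * (fpow t y (suc k) + a * fpow t y k)                     ≡⟨ distrib (pow y e) _ a _ ⟩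
    pow y e * fpow t y (suc k) + a * (pow y e * fpow t y k)           ≡⟨ cong₂ (λ u v → u + a * v) (pow-fpow-expansion e (suc k)) (pow-fpow-expansion e k) ⟩
    Σ< (suc e) (hcTerm e (suc k)) + a * Σ< (suc e) (hcTerm e k)       ≡⟨ hcTerm-recombine e k ⟩
    Σ< (suc (suc e)) (hcTerm (suc e) k)                               ∎
    where
    a = t (suc k)
    reorder : ∀ y p f → y * (p * f) ≡ p * (y * f)
    reorder = solve-∀ ℚ-ring
    distrib : ∀ p g a f → p * (g + a * f) ≡ p * g + a * (p * f)
    distrib = solve-∀ ℚ-ring

  hhTerm-recombine : ∀ c zs m k →
    Σ< (suc (suc m)) (hhTerm zs (suc m) k) + c * Σ< (suc m) (hhTerm zs m k) ≡ Σ< (suc (suc m)) (hhTerm (c ∷ zs) (suc m) k)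
  hhTerm-recombine c zs m k = begin
    Σ< (suc (suc m)) F + c * Σ< (suc m) G                 ≡⟨ cong (_+ c * Σ< (suc m) G) (Σ<-snoc (suc m) F) ⟩
    (Σ< (suc m) F + F (suc m)) + c * Σ< (suc m) G         ≡⟨ regroup (Σ< (suc m) F) (F (suc m)) c (Σ< (suc m) G) ⟩
    (Σ< (suc m) F + c * Σ< (suc m) G) + F (suc m)         ≡⟨ cong (λ s → (Σ< (suc m) F + s) + F (suc m)) (sym (Σ<-*ˡ (suc m) c G)) ⟩
    (Σ< (suc m) F + Σ< (suc m) (λ j → c * G j)) + F (suc m) ≡⟨ cong (_+ F (suc m)) (sym (Σ<-+ (suc m) F (λ j → c * G j))) ⟩
    Σ< (suc m) (λ j → F j + c * G j) + F (suc m)          ≡⟨ cong₂ _+_ (Σ<-cong (suc m) _ _ step) last ⟩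
    Σ< (suc m) H + H (suc m)                              ≡⟨ sym (Σ<-snoc (suc m) H) ⟩
    Σ< (suc (suc m)) H                                    ∎
    where
    F G H : ℕ → ℚ
    F = hhTerm zs (suc m) k
    G = hhTerm zs m k
    H = hhTerm (c ∷ zs) (suc m) k
    regroup : ∀ a b c d → (a + b) + c * d ≡ (a + c * d) + b
    regroup = solve-∀ ℚ-ring
    last : F (suc m) ≡ H (suc m)
    last = trans (cong (λ i → hh i (tSeg t (suc k) (suc (suc m))) zs * fpow t y (k ℕ.+ suc m)) (ℕₚ.n∸n≡0 m))
                 (cong (λ i → hh i (tSeg t (suc k) (suc (suc m))) (c ∷ zs) * fpow t y (k ℕ.+ suc m)) (sym (ℕₚ.n∸n≡0 m)))
    step : ∀ j → j < suc m → F j + c * G j ≡ H j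
    step j j<1+m = begin
      hh (suc m ∸ j) ts zs * f + c * (hh (m ∸ j) ts zs * f)          ≡⟨ cong (λ i → hh i ts zs * f + c * (hh (m ∸ j) ts zs * f)) m∸j ⟩
      hh (suc (m ∸ j)) ts zs * f + c * (hh (m ∸ j) ts zs * f)        ≡⟨ factor-out (hh (suc (m ∸ j)) ts zs) c (hh (m ∸ j) ts zs) f ⟩
      (hh (suc (m ∸ j)) ts zs + c * hh (m ∸ j) ts zs) * f            ≡⟨ cong (_* f) (sym (hh-∷ (m ∸ j) ts c zs)) ⟩
      hh (suc (m ∸ j)) ts (c ∷ zs) * f                               ≡⟨ cong (λ i → hh i ts (c ∷ zs) * f) (sym m∸j) ⟩
      H j                                                            ∎
      where
      ts = tSeg t (suc k) (suc j)
      f = fpow t y (k ℕ.+ j)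
      m∸j = m∸n≡suc[m∸suc[n]] (suc m) j j<1+m
      factor-out : ∀ a c b f → a * f + c * (b * f) ≡ (a + c * b) * f
      factor-out = solve-∀ ℚ-ring

  pow-Π⁺-fpow-expansion : ∀ zs e k →
    pow y e * Π⁺ y zs * fpow t y k ≡ Σ< (suc (length zs ℕ.+ e)) (hhTerm zs (length zs ℕ.+ e) k)
  pow-Π⁺-fpow-expansion [] e k = begin
    pow y e * 1ℚ * fpow t y k           ≡⟨ cong (_* fpow t y k) (ℚₚ.*-identityʳ (pow y e)) ⟩
    pow y e * fpow t y k                ≡⟨ pow-fpow-expansion e k ⟩
    Σ< (suc e) (hcTerm e k)             ≡⟨ Σ<-ext (suc e) _ _ (λ j → cong (_* fpow t y (k ℕ.+ j)) (sym (hh-[] (e ∸ j) (tSeg t (suc k) (suc j))))) ⟩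
    Σ< (suc e) (hhTerm [] e k)          ∎
  pow-Π⁺-fpow-expansion (c ∷ zs) e k = begin
    pow y e * ((y + c) * Π⁺ y zs) * fpow t y k
      ≡⟨ distrib y c (pow y e) (Π⁺ y zs) (fpow t y k) ⟩
    pow y (suc e) * Π⁺ y zs * fpow t y k + c * (pow y e * Π⁺ y zs * fpow t y k)
      ≡⟨ cong₂ (λ u v → u + c * v) (pow-Π⁺-fpow-expansion zs (suc e) k) (pow-Π⁺-fpow-expansion zs e k) ⟩
    Σ< (suc (length zs ℕ.+ suc e)) (hhTerm zs (length zs ℕ.+ suc e) k) + c * Σ< (suc m) (hhTerm zs m k)
      ≡⟨ cong (λ i → Σ< (suc i) (hhTerm zs i k) + c * Σ< (suc m) (hhTerm zs m k)) (ℕₚ.+-suc (length zs) e) ⟩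
    Σ< (suc (suc m)) (hhTerm zs (suc m) k) + c * Σ< (suc m) (hhTerm zs m k)
      ≡⟨ hhTerm-recombine c zs m k ⟩
    Σ< (suc (suc m)) (hhTerm (c ∷ zs) (suc m) k) ∎
    where
    m = length zs ℕ.+ e
    distrib : ∀ y c p q f → p * ((y + c) * q) * f ≡ (y * p) * q * f + c * (p * q * f)
    distrib = solve-∀ ℚ-ring

fromℕ≡mkℚ : ∀ m → fromℕ m ≡ ℚ.mkℚ (ℤ.+ m) 0 (Coprimality.sym (Coprimality.1-coprimeTo m))
fromℕ≡mkℚ m = ℚₚ.normalize-coprime (Coprimality.sym (Coprimality.1-coprimeTo m))

fromℕ-suc : ∀ m → fromℕ (suc m) ≡ 1ℚ + fromℕ m
fromℕ-suc m rewrite fromℕ≡mkℚ m | ℤₚ.*-identityʳ (ℤ.+ m) = refl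

fromℕ-+ : ∀ a b → fromℕ (a ℕ.+ b) ≡ fromℕ a + fromℕ b
fromℕ-+ zero    b = sym (ℚₚ.+-identityˡ _)
fromℕ-+ (suc a) b = begin
  fromℕ (suc (a ℕ.+ b))         ≡⟨ fromℕ-suc (a ℕ.+ b) ⟩
  1ℚ + fromℕ (a ℕ.+ b)          ≡⟨ cong (1ℚ +_) (fromℕ-+ a b) ⟩
  1ℚ + (fromℕ a + fromℕ b)      ≡⟨ sym (ℚₚ.+-assoc 1ℚ (fromℕ a) (fromℕ b)) ⟩
  (1ℚ + fromℕ a) + fromℕ b      ≡⟨ cong (_+ fromℕ b) (sym (fromℕ-suc a)) ⟩
  fromℕ (suc a) + fromℕ b       ∎

fromℕ-* : ∀ a b → fromℕ (a ℕ.* b) ≡ fromℕ a * fromℕ b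
fromℕ-* zero    b = sym (ℚₚ.*-zeroˡ (fromℕ b))
fromℕ-* (suc a) b = begin
  fromℕ (b ℕ.+ a ℕ.* b)         ≡⟨ fromℕ-+ b (a ℕ.* b) ⟩
  fromℕ b + fromℕ (a ℕ.* b)     ≡⟨ cong (fromℕ b +_) (fromℕ-* a b) ⟩
  fromℕ b + fromℕ a * fromℕ b   ≡⟨ collect (fromℕ a) (fromℕ b) ⟩
  (1ℚ + fromℕ a) * fromℕ b      ≡⟨ cong (_* fromℕ b) (sym (fromℕ-suc a)) ⟩
  fromℕ (suc a) * fromℕ b       ∎
  where
  collect : ∀ a b → b + a * b ≡ (1ℚ + a) * b
  collect = solve-∀ ℚ-ring

fromℕ-∸ : ∀ {a b} → b ≤ a → fromℕ (a ∸ b) ≡ fromℕ a - fromℕ b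
fromℕ-∸ {a} {b} b≤a = begin
  fromℕ (a ∸ b)                                  ≡⟨ add-sub (fromℕ (a ∸ b)) (fromℕ b) ⟩
  fromℕ (a ∸ b) + fromℕ b - fromℕ b              ≡⟨ cong (_- fromℕ b) (sym (fromℕ-+ (a ∸ b) b)) ⟩
  fromℕ (a ∸ b ℕ.+ b) - fromℕ b                  ≡⟨ cong (λ c → fromℕ c - fromℕ b) (ℕₚ.m∸n+n≡m b≤a) ⟩
  fromℕ a - fromℕ b                              ∎
  where
  add-sub : ∀ p q → p ≡ p + q - q
  add-sub = solve-∀ ℚ-ring

fromℕ≡0⇒≡0 : ∀ m → fromℕ m ≡ 0ℚ → m ≡ 0
fromℕ≡0⇒≡0 m m≡0 = ℤₚ.+-injective (cong ℚ.↥_ (trans (sym (fromℕ≡mkℚ m)) m≡0))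

fromℕ-!≢0 : ∀ m → fromℕ (m !) ≢ 0ℚ
fromℕ-!≢0 m m!≡0 = ℕₚ.<⇒≢ (ℕₚ.1≤n! m) (sym (fromℕ≡0⇒≡0 (m !) m!≡0))

module Distinctness (N : ℕ) where

  open Deletion (Finₚ._≟_ {N})

  I = allFin N

  _∈ᵇ_ : Fin N → List (Fin N) → Bool
  a ∈ᵇ []      = false
  a ∈ᵇ (c ∷ W) = does (a Finₚ.≟ c) ∨ a ∈ᵇ W

  distinctᵇ : List (Fin N) → Bool
  distinctᵇ []      = true
  distinctᵇ (c ∷ W) = not (c ∈ᵇ W) ∧ distinctᵇ W

  ≟-sym : ∀ (a c : Fin N) → does (a Finₚ.≟ c) ≡ does (c Finₚ.≟ a)
  ≟-sym a c with a Finₚ.≟ c | c Finₚ.≟ a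
  ... | yes _   | yes _   = refl
  ... | no _    | no _    = refl
  ... | yes a≡c | no c≢a  = ⊥-elim (c≢a (sym a≡c))
  ... | no a≢c  | yes c≡a = ⊥-elim (a≢c (sym c≡a))

  ∈ᵇ-snoc : ∀ a W c → a ∈ᵇ (W ++ [ c ]) ≡ a ∈ᵇ W ∨ does (a Finₚ.≟ c)
  ∈ᵇ-snoc a []      c = Boolₚ.∨-identityʳ (does (a Finₚ.≟ c))
  ∈ᵇ-snoc a (d ∷ W) c = trans (cong (does (a Finₚ.≟ d) ∨_) (∈ᵇ-snoc a W c)) (sym (Boolₚ.∨-assoc (does (a Finₚ.≟ d)) _ _))

  distinctᵇ-snoc : ∀ W a → distinctᵇ (W ++ [ a ]) ≡ not (a ∈ᵇ W) ∧ distinctᵇ W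
  distinctᵇ-snoc []      a = refl
  distinctᵇ-snoc (c ∷ W) a = begin
    not (c ∈ᵇ (W ++ [ a ])) ∧ distinctᵇ (W ++ [ a ])
      ≡⟨ cong₂ (λ u v → not u ∧ v) (∈ᵇ-snoc c W a) (distinctᵇ-snoc W a) ⟩
    not (c ∈ᵇ W ∨ does (c Finₚ.≟ a)) ∧ (not (a ∈ᵇ W) ∧ distinctᵇ W)
      ≡⟨ cong (λ u → not (c ∈ᵇ W ∨ u) ∧ (not (a ∈ᵇ W) ∧ distinctᵇ W)) (≟-sym c a) ⟩
    not (c ∈ᵇ W ∨ does (a Finₚ.≟ c)) ∧ (not (a ∈ᵇ W) ∧ distinctᵇ W)
      ≡⟨ shuffle (c ∈ᵇ W) (does (a Finₚ.≟ c)) (a ∈ᵇ W) (distinctᵇ W) ⟩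
    not (does (a Finₚ.≟ c) ∨ a ∈ᵇ W) ∧ (not (c ∈ᵇ W) ∧ distinctᵇ W) ∎
    where
    shuffle : ∀ p q r s → not (p ∨ q) ∧ (not r ∧ s) ≡ not (q ∨ r) ∧ (not p ∧ s)
    shuffle true  true  r     s = refl
    shuffle true  false true  s = refl
    shuffle true  false false s = refl
    shuffle false true  r     s = refl
    shuffle false false true  s = refl
    shuffle false false false s = refl

  distinctᵇ-rotate : ∀ a W → distinctᵇ (a ∷ W) ≡ distinctᵇ (W ++ [ a ])
  distinctᵇ-rotate a W = sym (distinctᵇ-snoc W a)

  distinctᵇ-rotate₂ : ∀ a b W → distinctᵇ (a ∷ b ∷ W) ≡ distinctᵇ (W ++ a ∷ b ∷ [])
  distinctᵇ-rotate₂ a b W = begin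
    distinctᵇ (a ∷ b ∷ W)              ≡⟨ distinctᵇ-rotate a (b ∷ W) ⟩
    distinctᵇ (b ∷ (W ++ [ a ]))        ≡⟨ distinctᵇ-rotate b (W ++ [ a ]) ⟩
    distinctᵇ ((W ++ [ a ]) ++ [ b ])   ≡⟨ cong distinctᵇ (++-assoc W [ a ] [ b ]) ⟩
    distinctᵇ (W ++ a ∷ b ∷ [])         ∎

  count-≡ : ∀ c → sumℚ (map (λ a → indicator (does (a Finₚ.≟ c))) I) ≡ 1ℚ
  count-≡ c = begin
    sumℚ (map (λ a → indicator (does (a Finₚ.≟ c))) I)
      ≡⟨ sum-delete (λ a → indicator (does (a Finₚ.≟ c))) (Uniqueₚ.allFin⁺ N) (∈-allFin c) ⟩
    indicator (does (c Finₚ.≟ c)) + sumℚ (map (λ a → indicator (does (a Finₚ.≟ c))) (delete c I))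
      ≡⟨ cong₂ _+_ (cong indicator (dec-true (c Finₚ.≟ c) refl)) (sum-0 _ (delete c I) off-diagonal) ⟩
    1ℚ + 0ℚ
      ≡⟨ ℚₚ.+-identityʳ 1ℚ ⟩
    1ℚ ∎
    where
    off-diagonal : ∀ a → a ∈ delete c I → indicator (does (a Finₚ.≟ c)) ≡ 0ℚ
    off-diagonal a a∈ with a Finₚ.≟ c
    ... | no _     = refl
    ... | yes a≡c  = ⊥-elim (proj₂ (∈-delete⁻ I a∈) a≡c)

  distinctᵇ-∷ : ∀ c W → distinctᵇ (c ∷ W) ≡ true → c ∈ᵇ W ≡ false × distinctᵇ W ≡ true
  distinctᵇ-∷ c W with c ∈ᵇ W | distinctᵇ W
  ... | false | true = λ _ → refl , refl
  ... | true  | _    = λ ()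
  ... | false | false = λ ()

  count-∈ᵇ : ∀ W → distinctᵇ W ≡ true → sumℚ (map (λ a → indicator (a ∈ᵇ W)) I) ≡ fromℕ (length W)
  count-∈ᵇ []      _        = sum-0 _ I (λ _ _ → refl)
  count-∈ᵇ (c ∷ W) distinct = begin
    sumℚ (map (λ a → indicator (does (a Finₚ.≟ c) ∨ a ∈ᵇ W)) I)
      ≡⟨ sum-ext _ _ I split ⟩
    sumℚ (map (λ a → indicator (does (a Finₚ.≟ c)) + indicator (a ∈ᵇ W)) I)
      ≡⟨ sum-+ _ _ I ⟩
    sumℚ (map (λ a → indicator (does (a Finₚ.≟ c))) I) + sumℚ (map (λ a → indicator (a ∈ᵇ W)) I)
      ≡⟨ cong₂ _+_ (count-≡ c) (count-∈ᵇ W (proj₂ (distinctᵇ-∷ c W distinct))) ⟩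
    1ℚ + fromℕ (length W)
      ≡⟨ sym (fromℕ-suc (length W)) ⟩
    fromℕ (suc (length W)) ∎
    where
    split : ∀ a → indicator (does (a Finₚ.≟ c) ∨ a ∈ᵇ W) ≡ indicator (does (a Finₚ.≟ c)) + indicator (a ∈ᵇ W)
    split a with a Finₚ.≟ c
    ... | yes a≡c = trans (sym (ℚₚ.+-identityʳ 1ℚ))
                          (cong (λ b → 1ℚ + indicator b) (sym (trans (cong (_∈ᵇ W) a≡c) (proj₁ (distinctᵇ-∷ c W distinct)))))
    ... | no _     = sym (ℚₚ.+-identityˡ _)

  count-∉ᵇ : ∀ W → distinctᵇ W ≡ true → sumℚ (map (λ a → indicator (not (a ∈ᵇ W))) I) ≡ fromℕ N - fromℕ (length W)
  count-∉ᵇ W distinct = begin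
    sumℚ (map (λ a → indicator (not (a ∈ᵇ W))) I)                   ≡⟨ sum-ext _ _ I (λ a → indicator-not (a ∈ᵇ W)) ⟩
    sumℚ (map (λ a → 1ℚ - indicator (a ∈ᵇ W)) I)                    ≡⟨ sum-sub _ _ I ⟩
    sumℚ (map (λ _ → 1ℚ) I) - sumℚ (map (λ a → indicator (a ∈ᵇ W)) I) ≡⟨ cong₂ _-_ (count-all I) (count-∈ᵇ W distinct) ⟩
    fromℕ (length I) - fromℕ (length W)                             ≡⟨ cong (λ m → fromℕ m - fromℕ (length W)) (length-tabulate {n = N} (λ i → i)) ⟩
    fromℕ N - fromℕ (length W)                                      ∎
    where
    count-all : ∀ (is : List (Fin N)) → sumℚ (map (λ _ → 1ℚ) is) ≡ fromℕ (length is)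
    count-all []       = refl
    count-all (_ ∷ is) = trans (cong (1ℚ +_) (count-all is)) (sym (fromℕ-suc (length is)))

  sum-allVecs-suc : ∀ m (F : Vec (Fin N) (suc m) → ℚ) →
    sumℚ (map F (allVecs N (suc m))) ≡ sumℚ (map (λ v → sumℚ (map (λ a → F (a Vec.∷ v)) I)) (allVecs N m))
  sum-allVecs-suc m F = begin
    sumℚ (map F (concatMap extend (allVecs N m)))                  ≡⟨ cong sumℚ (map-concatMap F extend (allVecs N m)) ⟩
    sumℚ (concatMap (map F ∘ extend) (allVecs N m))                ≡⟨ sum-concatMap (map F ∘ extend) (allVecs N m) ⟩
    sumℚ (map (λ v → sumℚ (map F (extend v))) (allVecs N m))      ≡⟨ sum-ext _ _ (allVecs N m) (λ v → sum-map F (Vec._∷ v) I) ⟩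
    sumℚ (map (λ v → sumℚ (map (λ a → F (a Vec.∷ v)) I)) (allVecs N m)) ∎
    where
    extend : Vec (Fin N) m → List (Vec (Fin N) (suc m))
    extend v = map (Vec._∷ v) I

  extensions : List (Fin N) → ℕ → ℚ
  extensions U m = sumℚ (map (λ v → indicator (distinctᵇ (toList v ++ U))) (allVecs N m))

  length-toList : ∀ {m} (v : Vec (Fin N) m) → length (toList v) ≡ m
  length-toList Vec.[]      = refl
  length-toList (a Vec.∷ v) = cong suc (length-toList v)

  extensions-suc : ∀ U m → m ℕ.+ length U ≤ N → extensions U (suc m) ≡ extensions U m * fromℕ (N ∸ (m ℕ.+ length U))
  extensions-suc U m m+|U|≤N = begin
    extensions U (suc m)
      ≡⟨ sum-allVecs-suc m (λ v → indicator (distinctᵇ (toList v ++ U))) ⟩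
    sumℚ (map (λ v → sumℚ (map (λ a → indicator (not (a ∈ᵇ (toList v ++ U)) ∧ distinctᵇ (toList v ++ U))) I)) (allVecs N m))
      ≡⟨ sum-ext _ _ (allVecs N m) fresh ⟩
    sumℚ (map (λ v → indicator (distinctᵇ (toList v ++ U)) * fromℕ (N ∸ (m ℕ.+ length U))) (allVecs N m))
      ≡⟨ sum-*ʳ _ _ (allVecs N m) ⟩
    extensions U m * fromℕ (N ∸ (m ℕ.+ length U)) ∎
    where
    fresh : ∀ v → sumℚ (map (λ a → indicator (not (a ∈ᵇ (toList v ++ U)) ∧ distinctᵇ (toList v ++ U))) I)
                  ≡ indicator (distinctᵇ (toList v ++ U)) * fromℕ (N ∸ (m ℕ.+ length U))
    fresh v with distinctᵇ (toList v ++ U) in distinct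
    ... | false = trans (sum-0 _ I (λ a _ → cong indicator (Boolₚ.∧-zeroʳ (not (a ∈ᵇ (toList v ++ U))))))
                        (sym (ℚₚ.*-zeroˡ (fromℕ (N ∸ (m ℕ.+ length U)))))
    ... | true  = begin
      sumℚ (map (λ a → indicator (not (a ∈ᵇ (toList v ++ U)) ∧ true)) I)
        ≡⟨ sum-ext _ _ I (λ a → cong indicator (Boolₚ.∧-identityʳ (not (a ∈ᵇ (toList v ++ U))))) ⟩
      sumℚ (map (λ a → indicator (not (a ∈ᵇ (toList v ++ U)))) I)
        ≡⟨ count-∉ᵇ (toList v ++ U) distinct ⟩
      fromℕ N - fromℕ (length (toList v ++ U))
        ≡⟨ cong (λ l → fromℕ N - fromℕ l) (trans (length-++ (toList v)) (cong (ℕ._+ length U) (length-toList v))) ⟩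
      fromℕ N - fromℕ (m ℕ.+ length U)
        ≡⟨ trans (sym (fromℕ-∸ m+|U|≤N)) (sym (ℚₚ.*-identityˡ _)) ⟩
      1ℚ * fromℕ (N ∸ (m ℕ.+ length U)) ∎

  extensions-count : ∀ U → distinctᵇ U ≡ true → ∀ m → m ℕ.+ length U ≤ N →
                     extensions U m ≡ fromℕ ((N ∸ length U) P′ m)
  extensions-count U distinct zero    _ = trans (ℚₚ.+-identityʳ _) (cong indicator distinct)
  extensions-count U distinct (suc m) 1+m+|U|≤N = begin
    extensions U (suc m)                                   ≡⟨ extensions-suc U m m+|U|≤N ⟩
    extensions U m * fromℕ (N ∸ (m ℕ.+ length U))          ≡⟨ cong₂ (λ e r → e * fromℕ r) (extensions-count U distinct m m+|U|≤N) remaining ⟩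
    fromℕ (K P′ m) * fromℕ (K ∸ m)                         ≡⟨ trans (ℚₚ.*-comm (fromℕ (K P′ m)) (fromℕ (K ∸ m))) (sym (fromℕ-* (K ∸ m) (K P′ m))) ⟩
    fromℕ (K P′ suc m)                                     ∎
    where
    K = N ∸ length U
    m+|U|≤N = ℕₚ.<⇒≤ 1+m+|U|≤N
    remaining : N ∸ (m ℕ.+ length U) ≡ K ∸ m
    remaining = trans (cong (N ∸_) (ℕₚ.+-comm m (length U))) (sym (ℕₚ.∸-+-assoc N (length U) m))

  extensions-non-distinct : ∀ U m → distinctᵇ U ≡ false → extensions U m ≡ 0ℚ
  extensions-non-distinct U m repeated = sum-0 _ (allVecs N m) (λ v _ → cong indicator (suffix (toList v)))
    where
    suffix : ∀ W → distinctᵇ (W ++ U) ≡ false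
    suffix []      = repeated
    suffix (c ∷ W) rewrite suffix W = Boolₚ.∧-zeroʳ (not (c ∈ᵇ (W ++ U)))

-- Symmetrisation over S_N

IsInjective : ∀ {n m} → Vec (Fin n) m → Set
IsInjective v = ∀ i j → lookup v i ≡ lookup v j → i ≡ j

-- isInjective tests each pair (i , j) with a Boolean built from a function local to its where-block;
-- pairTest recovers that test by unification.
pairTest : ∀ {n m} (v : Vec (Fin n) m) →
  Σ (Fin m → Fin m → Bool) (λ test → isInjective v ≡ foldr _∧_ true (concatMap (λ i → map (test i) (allFin m)) (allFin m)))
pairTest v = _ , refl

pairTest-sound : ∀ {n m} (v : Vec (Fin n) m) i j → proj₁ (pairTest v) i j ≡ true → lookup v i ≡ lookup v j → i ≡ j
pairTest-sound v i j passes vi≡vj with i Finₚ.≟ j | lookup v i Finₚ.≟ lookup v j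
pairTest-sound v i j passes vi≡vj | yes i≡j | _        = i≡j
pairTest-sound v i j ()     vi≡vj | no _    | yes _
pairTest-sound v i j passes vi≡vj | no _    | no vi≢vj = ⊥-elim (vi≢vj vi≡vj)

pairTest-complete : ∀ {n m} (v : Vec (Fin n) m) → IsInjective v → ∀ i j → proj₁ (pairTest v) i j ≡ true
pairTest-complete v injective i j with i Finₚ.≟ j | lookup v i Finₚ.≟ lookup v j
... | yes _ | _        = refl
... | no i≢j | yes vi≡vj = ⊥-elim (i≢j (injective i j vi≡vj))
... | no _  | no _     = refl

foldr-∧-true⁻ : ∀ bs → foldr _∧_ true bs ≡ true → ∀ {b} → b ∈ bs → b ≡ true
foldr-∧-true⁻ (true ∷ bs) _       (here refl) = refl
foldr-∧-true⁻ (true ∷ bs) all-true (there b∈) = foldr-∧-true⁻ bs all-true b∈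
foldr-∧-true⁻ (false ∷ bs) ()

foldr-∧-true⁺ : ∀ bs → (∀ {b} → b ∈ bs → b ≡ true) → foldr _∧_ true bs ≡ true
foldr-∧-true⁺ []       _        = refl
foldr-∧-true⁺ (b ∷ bs) all-true rewrite all-true (here refl) = foldr-∧-true⁺ bs (all-true ∘ there)

isInjective-sound : ∀ {n m} (v : Vec (Fin n) m) → isInjective v ≡ true → IsInjective v
isInjective-sound {m = m} v passes i j = pairTest-sound v i j
  (foldr-∧-true⁻ _ (trans (sym (proj₂ (pairTest v))) passes)
     (∈-concatMap⁺ row (Any.map (λ { refl → ∈-map⁺ (proj₁ (pairTest v) i) (∈-allFin j) }) (∈-allFin i))))
  where
  row : Fin m → List Bool
  row i = map (proj₁ (pairTest v) i) (allFin m)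

isInjective-complete : ∀ {n m} (v : Vec (Fin n) m) → IsInjective v → isInjective v ≡ true
isInjective-complete {m = m} v injective = trans (proj₂ (pairTest v)) (foldr-∧-true⁺ _ all-pass)
  where
  all-pass : ∀ {b} → b ∈ concatMap (λ i → map (proj₁ (pairTest v) i) (allFin m)) (allFin m) → b ≡ true
  all-pass b∈ with Any.satisfied (∈-concatMap⁻ (λ i → map (proj₁ (pairTest v) i) (allFin m)) {xs = allFin m} b∈)
  ... | i , b∈row with ∈-map⁻ (proj₁ (pairTest v) i) b∈row
  ...   | j , _ , refl = pairTest-complete v injective i j

module _ {n : ℕ} where

  open Distinctness n

  ∈ᵇ-toList⁻ : ∀ {m} a (v : Vec (Fin n) m) → a ∈ᵇ toList v ≡ true → ∃ λ j → a ≡ lookup v j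
  ∈ᵇ-toList⁻ a (c Vec.∷ v) a∈ with a Finₚ.≟ c
  ... | yes a≡c = Fin.zero , a≡c
  ... | no _    = let j , a≡vj = ∈ᵇ-toList⁻ a v a∈ in Fin.suc j , a≡vj

  ∈ᵇ-toList⁺ : ∀ {m} a (v : Vec (Fin n) m) j → a ≡ lookup v j → a ∈ᵇ toList v ≡ true
  ∈ᵇ-toList⁺ a (c Vec.∷ v) j a≡vj with a Finₚ.≟ c | j
  ... | yes _   | _        = refl
  ... | no a≢c  | Fin.zero  = ⊥-elim (a≢c a≡vj)
  ... | no _    | Fin.suc j = ∈ᵇ-toList⁺ a v j a≡vj

  distinctᵇ-head : ∀ a W → distinctᵇ (a ∷ W) ≡ true → a ∈ᵇ W ≢ true
  distinctᵇ-head a W distinct a∈W with trans (sym a∈W) (proj₁ (distinctᵇ-∷ a W distinct))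
  ... | ()

  distinctᵇ-sound : ∀ {m} (v : Vec (Fin n) m) → distinctᵇ (toList v) ≡ true → IsInjective v
  distinctᵇ-sound (a Vec.∷ v) distinct Fin.zero    Fin.zero    _     = refl
  distinctᵇ-sound (a Vec.∷ v) distinct Fin.zero    (Fin.suc j) a≡vj  = ⊥-elim (distinctᵇ-head a (toList v) distinct (∈ᵇ-toList⁺ a v j a≡vj))
  distinctᵇ-sound (a Vec.∷ v) distinct (Fin.suc i) Fin.zero    vi≡a  = ⊥-elim (distinctᵇ-head a (toList v) distinct (∈ᵇ-toList⁺ a v i (sym vi≡a)))
  distinctᵇ-sound (a Vec.∷ v) distinct (Fin.suc i) (Fin.suc j) vi≡vj =
    cong Fin.suc (distinctᵇ-sound v (proj₂ (distinctᵇ-∷ a (toList v) distinct)) i j vi≡vj)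

  distinctᵇ-complete : ∀ {m} (v : Vec (Fin n) m) → IsInjective v → distinctᵇ (toList v) ≡ true
  distinctᵇ-complete Vec.[]      _         = refl
  distinctᵇ-complete (a Vec.∷ v) injective with a ∈ᵇ toList v in a∈v
  ... | true  with () ← injective Fin.zero (Fin.suc (proj₁ (∈ᵇ-toList⁻ a v a∈v))) (proj₂ (∈ᵇ-toList⁻ a v a∈v))
  ... | false = distinctᵇ-complete v (λ i j vi≡vj → Finₚ.suc-injective (injective (Fin.suc i) (Fin.suc j) vi≡vj))

  isInjective≡distinctᵇ : ∀ {m} (v : Vec (Fin n) m) → isInjective v ≡ distinctᵇ (toList v)
  isInjective≡distinctᵇ v with isInjective v in passes | distinctᵇ (toList v) in distinct
  ... | true  | true  = refl
  ... | false | false = refl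
  ... | true  | false = sym (trans (sym distinct) (distinctᵇ-complete v (isInjective-sound v passes)))
  ... | false | true  = trans (sym passes) (isInjective-complete v (distinctᵇ-sound v distinct))

  sum-perms : ∀ (F : Vec (Fin n) n → ℚ) →
    sumℚ (map F (perms n)) ≡ sumℚ (map (λ v → indicator (distinctᵇ (toList v)) * F v) (allVecs n n))
  sum-perms F = trans (sum-filter (λ v → isInjective v Boolₚ.≟ true) F (allVecs n n))
                      (sum-ext _ _ (allVecs n n) (λ v → cong (λ b → indicator b * F v) (trans (does-≟-true (isInjective v)) (isInjective≡distinctᵇ v))))
    where
    does-≟-true : ∀ b → does (b Boolₚ.≟ true) ≡ b
    does-≟-true true  = refl
    does-≟-true false = refl

injective⇒surjective : ∀ {n} (v : Vec (Fin n) n) → IsInjective v → ∀ c → ∃ λ j → lookup v j ≡ c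
injective⇒surjective {suc n} v injective c with Finₚ.any? (λ j → lookup v j Finₚ.≟ c)
... | yes hit = hit
... | no miss = ⊥-elim (collision (Finₚ.pigeonhole (ℕₚ.n<1+n n) squeeze))
  where
  c≢v : ∀ j → c ≢ lookup v j
  c≢v j c≡vj = miss (j , sym c≡vj)
  squeeze : Fin (suc n) → Fin n
  squeeze j = Fin.punchOut (c≢v j)
  collision : (∃ λ i → ∃ λ j → i Fin.< j × squeeze i ≡ squeeze j) → ⊥
  collision (i , j , i<j , same) =
    ℕₚ.<-irrefl (cong toℕ (injective i j (Finₚ.punchOut-injective (c≢v i) (c≢v j) same))) i<j

module Symmetrisation (n : ℕ) (x : Fin (suc (suc n)) → ℚ) (x-injective : ∀ i j → x i ≡ x j → i ≡ j)
                      (n+1-odd : parity (suc n) ≡ 1ℚ) (t : ℕ → ℚ) where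

  open TwoRows (suc n) x x-injective n+1-odd
  open Distinctness N hiding (I)

  extensions-diagonal : ∀ a → extensions (a ∷ a ∷ []) n ≡ 0ℚ
  extensions-diagonal a = extensions-non-distinct (a ∷ a ∷ []) n (cong (λ b → not (b ∨ false) ∧ true) (dec-true (a Finₚ.≟ a) refl))

  extensions-off-diagonal : ∀ {a b} → b ≢ a → extensions (a ∷ b ∷ []) n ≡ fromℕ (n !)
  extensions-off-diagonal {a} {b} b≢a =
    trans (extensions-count (a ∷ b ∷ []) distinct n (ℕₚ.≤-reflexive (ℕₚ.+-comm n 2))) (cong fromℕ (nP′n≡n! n))
    where
    distinct : distinctᵇ (a ∷ b ∷ []) ≡ true
    distinct = cong (λ b → not (b ∨ false) ∧ true) (dec-false (a Finₚ.≟ b) (b≢a ∘ sym))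

  sum-distinct-prefix₂ : ∀ (H : Fin N → Fin N → ℚ) →
    sumℚ (map (λ v → indicator (distinctᵇ (toList v)) * H (lookup v Fin.zero) (lookup v (Fin.suc Fin.zero))) (allVecs N N))
    ≡ sumℚ (map (λ a → sumℚ (map (λ b → extensions (a ∷ b ∷ []) n * H a b) I)) I)
  sum-distinct-prefix₂ H = begin
    sumℚ (map Φ (allVecs N N))
      ≡⟨ sum-allVecs-suc (suc n) Φ ⟩
    sumℚ (map (λ v → sumℚ (map (λ a → Φ (a Vec.∷ v)) I)) (allVecs N (suc n)))
      ≡⟨ sum-allVecs-suc n (λ v → sumℚ (map (λ a → Φ (a Vec.∷ v)) I)) ⟩
    sumℚ (map (λ r → sumℚ (map (λ b → sumℚ (map (λ a → Φ (a Vec.∷ b Vec.∷ r)) I)) I)) (allVecs N n))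
      ≡⟨ sum-ext _ _ (allVecs N n) (λ r → sum-ext _ _ I (λ b → sum-ext _ _ I (λ a →
           cong (λ d → indicator d * H a b) (distinctᵇ-rotate₂ a b (toList r))))) ⟩
    sumℚ (map (λ r → sumℚ (map (λ b → sumℚ (map (λ a → X r a b) I)) I)) (allVecs N n))
      ≡⟨ sum-ext _ _ (allVecs N n) (λ r → sum-swap (λ b a → X r a b) I I) ⟩
    sumℚ (map (λ r → sumℚ (map (λ a → sumℚ (map (X r a) I)) I)) (allVecs N n))
      ≡⟨ sum-swap (λ r a → sumℚ (map (X r a) I)) (allVecs N n) I ⟩
    sumℚ (map (λ a → sumℚ (map (λ r → sumℚ (map (X r a) I)) (allVecs N n))) I)
      ≡⟨ sum-ext _ _ I (λ a → sum-swap (λ r b → X r a b) (allVecs N n) I) ⟩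
    sumℚ (map (λ a → sumℚ (map (λ b → sumℚ (map (λ r → X r a b) (allVecs N n))) I)) I)
      ≡⟨ sum-ext _ _ I (λ a → sum-ext _ _ I (λ b → sum-*ʳ (H a b) (λ r → indicator (distinctᵇ (toList r ++ a ∷ b ∷ []))) (allVecs N n))) ⟩
    sumℚ (map (λ a → sumℚ (map (λ b → extensions (a ∷ b ∷ []) n * H a b) I)) I) ∎
    where
    Φ : Vec (Fin N) N → ℚ
    Φ v = indicator (distinctᵇ (toList v)) * H (lookup v Fin.zero) (lookup v (Fin.suc Fin.zero))
    X : Vec (Fin N) n → Fin N → Fin N → ℚ
    X r a b = indicator (distinctᵇ (toList r ++ a ∷ b ∷ [])) * H a b

  sum-distinct-vectors₂ : ∀ (H : Fin N → Fin N → ℚ) →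
    sumℚ (map (λ v → indicator (distinctᵇ (toList v)) * H (lookup v Fin.zero) (lookup v (Fin.suc Fin.zero))) (allVecs N N))
    ≡ fromℕ (n !) * pairSum H
  sum-distinct-vectors₂ H = begin
    _ ≡⟨ sum-distinct-prefix₂ H ⟩
    sumℚ (map (λ a → sumℚ (map (λ b → extensions (a ∷ b ∷ []) n * H a b) I)) I)
      ≡⟨ sum-ext _ _ I (λ a → sum-delete (λ b → extensions (a ∷ b ∷ []) n * H a b) I-unique (∈-allFin a)) ⟩
    sumℚ (map (λ a → extensions (a ∷ a ∷ []) n * H a a + sumℚ (map (λ b → extensions (a ∷ b ∷ []) n * H a b) (delete a I))) I)
      ≡⟨ sum-ext _ _ I (λ a → cong₂ _+_ (trans (cong (_* H a a) (extensions-diagonal a)) (ℚₚ.*-zeroˡ (H a a)))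
                                         (sum-cong _ _ (delete a I) (λ b b∈ → cong (_* H a b) (extensions-off-diagonal (proj₂ (∈-delete⁻ I b∈)))))) ⟩
    sumℚ (map (λ a → 0ℚ + sumℚ (map (λ b → fromℕ (n !) * H a b) (delete a I))) I)
      ≡⟨ sum-ext _ _ I (λ a → trans (ℚₚ.+-identityˡ _) (sum-*ˡ (fromℕ (n !)) (H a) (delete a I))) ⟩
    sumℚ (map (λ a → fromℕ (n !) * sumℚ (map (H a) (delete a I))) I)
      ≡⟨ sum-*ˡ (fromℕ (n !)) _ I ⟩
    fromℕ (n !) * pairSum H ∎

  sum-distinct-vectors₁ : ∀ (H : Fin N → ℚ) →
    sumℚ (map (λ v → indicator (distinctᵇ (toList v)) * H (lookup v Fin.zero)) (allVecs N N)) ≡ fromℕ (suc n !) * sumℚ (map H I)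
  sum-distinct-vectors₁ H = begin
    sumℚ (map Φ (allVecs N N))
      ≡⟨ sum-allVecs-suc (suc n) Φ ⟩
    sumℚ (map (λ r → sumℚ (map (λ a → Φ (a Vec.∷ r)) I)) (allVecs N (suc n)))
      ≡⟨ sum-ext _ _ (allVecs N (suc n)) (λ r → sum-ext _ _ I (λ a → cong (λ d → indicator d * H a) (distinctᵇ-rotate a (toList r)))) ⟩
    sumℚ (map (λ r → sumℚ (map (X r) I)) (allVecs N (suc n)))
      ≡⟨ sum-swap X (allVecs N (suc n)) I ⟩
    sumℚ (map (λ a → sumℚ (map (λ r → X r a) (allVecs N (suc n)))) I)
      ≡⟨ sum-ext _ _ I (λ a → sum-*ʳ (H a) (λ r → indicator (distinctᵇ (toList r ++ [ a ]))) (allVecs N (suc n))) ⟩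
    sumℚ (map (λ a → extensions [ a ] (suc n) * H a) I)
      ≡⟨ sum-ext _ _ I (λ a → cong (_* H a) (trans (extensions-count [ a ] refl (suc n) (ℕₚ.≤-reflexive (ℕₚ.+-comm (suc n) 1)))
                                                    (cong fromℕ (nP′n≡n! (suc n))))) ⟩
    sumℚ (map (λ a → fromℕ (suc n !) * H a) I)
      ≡⟨ sum-*ˡ (fromℕ (suc n !)) H I ⟩
    fromℕ (suc n !) * sumℚ (map H I) ∎
    where
    Φ : Vec (Fin N) N → ℚ
    Φ v = indicator (distinctᵇ (toList v)) * H (lookup v Fin.zero)
    X : Vec (Fin N) (suc n) → Fin N → ℚ
    X r a = indicator (distinctᵇ (toList r ++ [ a ])) * H a

  -- Pterm multiplies, over the rows i < ℓ, a factor that is local to its where-block; rowFactor recovers it by unification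
  rowFactor : (lam : List ℕ) (y : Fin N → ℚ) →
    Σ (Fin N → ℚ) (λ row → Pterm N t lam y ≡ prodℚ (map row (filter (λ i → toℕ i <? length lam) (allFin N))))
  rowFactor lam y = _ , refl

  rows₁ : filter (λ i → toℕ i <? 1) (allFin N) ≡ Fin.zero ∷ []
  rows₁ = cong (Fin.zero ∷_) (filter-none (λ i → toℕ i <? 1) (Allₚ.tabulate⁺ {f = Fin.suc} (λ i → ℕₚ.≤⇒≯ (s≤s z≤n))))

  rows₂ : filter (λ i → toℕ i <? 2) (allFin N) ≡ Fin.zero ∷ Fin.suc Fin.zero ∷ []
  rows₂ = cong (λ is → Fin.zero ∷ Fin.suc Fin.zero ∷ is) (filter-none (λ i → toℕ i <? 2) (Allₚ.tabulate⁺ {f = Fin.suc ∘ Fin.suc} (λ i → ℕₚ.≤⇒≯ (s≤s (s≤s z≤n)))))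

  module _ (v : Vec (Fin N) N) (injective : IsInjective v) where

    later : ℕ → List (Fin N)
    later k = filter (λ j → k <? toℕ j) (allFin N)

    image-later-unique : ∀ k → Unique (map (lookup v) (later k))
    image-later-unique k = Uniqueₚ.map⁺ (λ {i} {j} → injective i j) (Uniqueₚ.filter⁺ (λ j → k <? toℕ j) I-unique)

    image-later⁻ : ∀ k {c} → c ∈ map (lookup v) (later k) → ∀ i → toℕ i ≤ k → c ≢ lookup v i
    image-later⁻ k c∈ i i≤k c≡vi with ∈-map⁻ (lookup v) c∈
    ... | j , j∈ , refl with injective j i c≡vi
    ...   | refl = ℕₚ.<⇒≱ (proj₂ (∈-filter⁻ (λ j → k <? toℕ j) {xs = allFin N} j∈)) i≤k

    image-later⁺ : ∀ k {c} → (∀ i → toℕ i ≤ k → c ≢ lookup v i) → c ∈ map (lookup v) (later k)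
    image-later⁺ k {c} fresh with injective⇒surjective v injective c
    ... | j , vj≡c with k <? toℕ j
    ...   | yes k<j = subst (_∈ map (lookup v) (later k)) vj≡c (∈-map⁺ (lookup v) (∈-filter⁺ (λ j → k <? toℕ j) (∈-allFin j) k<j))
    ...   | no k≮j  = ⊥-elim (fresh j (ℕₚ.≮⇒≥ k≮j) (sym vj≡c))

    prod-later-0 : prodℚ (map (λ j → factor (x (lookup v Fin.zero)) (x (lookup v j))) (later 0)) ≡ w₁ (lookup v Fin.zero)
    prod-later-0 = trans (sym (prod-map (λ c → factor (x v₀) (x c)) (lookup v) (later 0)))
                         (prod-unique-cong _ (image-later-unique 0) (delete-unique v₀ I-unique) ⊆ ⊇)
      where
      v₀ = lookup v Fin.zero
      ⊆ : ∀ {c} → c ∈ map (lookup v) (later 0) → c ∈ delete v₀ I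
      ⊆ c∈ = ∈-delete⁺ (∈-allFin _) (image-later⁻ 0 c∈ Fin.zero z≤n)
      ⊇ : ∀ {c} → c ∈ delete v₀ I → c ∈ map (lookup v) (later 0)
      ⊇ c∈ = image-later⁺ 0 λ { Fin.zero _ → proj₂ (∈-delete⁻ I c∈) }

    prod-later-1 : prodℚ (map (λ j → factor (x (lookup v (Fin.suc Fin.zero))) (x (lookup v j))) (later 1))
                   ≡ w₂ (lookup v Fin.zero) (lookup v (Fin.suc Fin.zero))
    prod-later-1 = trans (sym (prod-map (λ c → factor (x v₁) (x c)) (lookup v) (later 1)))
                         (prod-unique-cong _ (image-later-unique 1) (delete-unique v₁ (delete-unique v₀ I-unique)) ⊆ ⊇)
      where
      v₀ = lookup v Fin.zero
      v₁ = lookup v (Fin.suc Fin.zero)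
      ⊆ : ∀ {c} → c ∈ map (lookup v) (later 1) → c ∈ delete v₁ (delete v₀ I)
      ⊆ c∈ = ∈-delete⁺ (∈-delete⁺ (∈-allFin _) (image-later⁻ 1 c∈ Fin.zero z≤n)) (image-later⁻ 1 c∈ (Fin.suc Fin.zero) (s≤s z≤n))
      ⊇ : ∀ {c} → c ∈ delete v₁ (delete v₀ I) → c ∈ map (lookup v) (later 1)
      ⊇ {c} c∈ = image-later⁺ 1 λ where
        Fin.zero             _         → proj₂ (∈-delete⁻ I (proj₁ (∈-delete⁻ (delete v₀ I) c∈)))
        (Fin.suc Fin.zero)   _         → proj₂ (∈-delete⁻ (delete v₀ I) c∈)
        (Fin.suc (Fin.suc _)) (s≤s ())

    Pterm-row : ∀ r → Pterm N t (r ∷ []) (x ∘ lookup v) ≡ fpow t (x (lookup v Fin.zero)) r * w₁ (lookup v Fin.zero)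
    Pterm-row r = begin
      Pterm N t (r ∷ []) (x ∘ lookup v)                     ≡⟨ proj₂ (rowFactor (r ∷ []) (x ∘ lookup v)) ⟩
      prodℚ (map row (filter (λ i → toℕ i <? 1) (allFin N))) ≡⟨ cong (prodℚ ∘ map row) rows₁ ⟩
      row Fin.zero * 1ℚ                                     ≡⟨ ℚₚ.*-identityʳ _ ⟩
      row Fin.zero                                          ≡⟨ cong (fpow t (x (lookup v Fin.zero)) r *_) prod-later-0 ⟩
      fpow t (x (lookup v Fin.zero)) r * w₁ (lookup v Fin.zero) ∎
      where
      row = proj₁ (rowFactor (r ∷ []) (x ∘ lookup v))

    Pterm-two-rows : ∀ k l → Pterm N t (k ∷ l ∷ []) (x ∘ lookup v)
      ≡ fpow t (x (lookup v Fin.zero)) k * fpow t (x (lookup v (Fin.suc Fin.zero))) l * (w₁ (lookup v Fin.zero) * w₂ (lookup v Fin.zero) (lookup v (Fin.suc Fin.zero)))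
    Pterm-two-rows k l = begin
      Pterm N t (k ∷ l ∷ []) (x ∘ lookup v)                     ≡⟨ proj₂ (rowFactor (k ∷ l ∷ []) (x ∘ lookup v)) ⟩
      prodℚ (map row (filter (λ i → toℕ i <? 2) (allFin N)))    ≡⟨ cong (prodℚ ∘ map row) rows₂ ⟩
      row Fin.zero * (row (Fin.suc Fin.zero) * 1ℚ)              ≡⟨ cong₂ (λ u w → u * (w * 1ℚ)) (cong (fpow t (x v₀) k *_) prod-later-0)
                                                                                                  (cong (fpow t (x v₁) l *_) prod-later-1) ⟩
      (fpow t (x v₀) k * w₁ v₀) * ((fpow t (x v₁) l * w₂ v₀ v₁) * 1ℚ) ≡⟨ regroup (fpow t (x v₀) k) (w₁ v₀) (fpow t (x v₁) l) (w₂ v₀ v₁) ⟩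
      fpow t (x v₀) k * fpow t (x v₁) l * (w₁ v₀ * w₂ v₀ v₁)   ∎
      where
      v₀ = lookup v Fin.zero
      v₁ = lookup v (Fin.suc Fin.zero)
      row = proj₁ (rowFactor (k ∷ l ∷ []) (x ∘ lookup v))
      regroup : ∀ a b c d → (a * b) * ((c * d) * 1ℚ) ≡ a * c * (b * d)
      regroup = solve-∀ ℚ-ring

  Pfun-row : ∀ r → Pfun N t (r ∷ []) x ≡ S₁ (λ y → fpow t y r)
  Pfun-row r = begin
    (1ℚ ÷' fromℕ (suc n !)) * sumℚ (map (λ w → Pterm N t (r ∷ []) (x ∘ lookup w)) (perms N))
      ≡⟨ cong ((1ℚ ÷' fromℕ (suc n !)) *_) (sum-perms (λ w → Pterm N t (r ∷ []) (x ∘ lookup w))) ⟩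
    (1ℚ ÷' fromℕ (suc n !)) * sumℚ (map (λ v → indicator (distinctᵇ (toList v)) * Pterm N t (r ∷ []) (x ∘ lookup v)) (allVecs N N))
      ≡⟨ cong ((1ℚ ÷' fromℕ (suc n !)) *_) (sum-ext _ _ (allVecs N N) evaluate) ⟩
    (1ℚ ÷' fromℕ (suc n !)) * sumℚ (map (λ v → indicator (distinctᵇ (toList v)) * H (lookup v Fin.zero)) (allVecs N N))
      ≡⟨ cong ((1ℚ ÷' fromℕ (suc n !)) *_) (sum-distinct-vectors₁ H) ⟩
    (1ℚ ÷' fromℕ (suc n !)) * (fromℕ (suc n !) * sumℚ (map H I))
      ≡⟨ 1÷'-*-cancelˡ (fromℕ (suc n !)) _ (fromℕ-!≢0 (suc n)) ⟩
    S₁ (λ y → fpow t y r) ∎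
    where
    H : Fin N → ℚ
    H a = fpow t (x a) r * w₁ a
    evaluate : ∀ v → indicator (distinctᵇ (toList v)) * Pterm N t (r ∷ []) (x ∘ lookup v) ≡ indicator (distinctᵇ (toList v)) * H (lookup v Fin.zero)
    evaluate v with distinctᵇ (toList v) in distinct
    ... | true  = cong (1ℚ *_) (Pterm-row v (distinctᵇ-sound v distinct) r)
    ... | false = trans (ℚₚ.*-zeroˡ (Pterm N t (r ∷ []) (x ∘ lookup v))) (sym (ℚₚ.*-zeroˡ (H (lookup v Fin.zero))))

  Pfun-two-rows : ∀ k l → Pfun N t (k ∷ l ∷ []) x ≡ S₂ (λ y → fpow t y k) (λ y → fpow t y l)
  Pfun-two-rows k l = begin
    (1ℚ ÷' fromℕ (n !)) * sumℚ (map (λ w → Pterm N t (k ∷ l ∷ []) (x ∘ lookup w)) (perms N))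
      ≡⟨ cong ((1ℚ ÷' fromℕ (n !)) *_) (sum-perms (λ w → Pterm N t (k ∷ l ∷ []) (x ∘ lookup w))) ⟩
    (1ℚ ÷' fromℕ (n !)) * sumℚ (map (λ v → indicator (distinctᵇ (toList v)) * Pterm N t (k ∷ l ∷ []) (x ∘ lookup v)) (allVecs N N))
      ≡⟨ cong ((1ℚ ÷' fromℕ (n !)) *_) (sum-ext _ _ (allVecs N N) evaluate) ⟩
    (1ℚ ÷' fromℕ (n !)) * sumℚ (map (λ v → indicator (distinctᵇ (toList v)) * H (lookup v Fin.zero) (lookup v (Fin.suc Fin.zero))) (allVecs N N))
      ≡⟨ cong ((1ℚ ÷' fromℕ (n !)) *_) (sum-distinct-vectors₂ H) ⟩
    (1ℚ ÷' fromℕ (n !)) * (fromℕ (n !) * pairSum H)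
      ≡⟨ 1÷'-*-cancelˡ (fromℕ (n !)) _ (fromℕ-!≢0 n) ⟩
    S₂ (λ y → fpow t y k) (λ y → fpow t y l) ∎
    where
    H : Fin N → Fin N → ℚ
    H a b = fpow t (x a) k * fpow t (x b) l * (w₁ a * w₂ a b)
    evaluate : ∀ v → indicator (distinctᵇ (toList v)) * Pterm N t (k ∷ l ∷ []) (x ∘ lookup v)
                     ≡ indicator (distinctᵇ (toList v)) * H (lookup v Fin.zero) (lookup v (Fin.suc Fin.zero))
    evaluate v with distinctᵇ (toList v) in distinct
    ... | true  = cong (1ℚ *_) (Pterm-two-rows v (distinctᵇ-sound v distinct) k l)
    ... | false = trans (ℚₚ.*-zeroˡ (Pterm N t (k ∷ l ∷ []) (x ∘ lookup v)))
                        (sym (ℚₚ.*-zeroˡ (H (lookup v Fin.zero) (lookup v (Fin.suc Fin.zero)))))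

⌊⌋≡true : ∀ {A : Set} (a? : Dec A) → A → ⌊ a? ⌋ ≡ true
⌊⌋≡true a? a = trans (isYes≗does a?) (dec-true a? a)

⌊⌋≡false : ∀ {A : Set} (a? : Dec A) → ¬ A → ⌊ a? ⌋ ≡ false
⌊⌋≡false a? ¬a = trans (isYes≗does a?) (dec-false a? ¬a)

inI-true : ∀ {k l r s} → k ≤ r → r ≤ k ℕ.+ l → s ≤ l → r ℕ.+ s ≤ k ℕ.+ l → ¬ (r ≡ k × s ≡ l) → inI k l r s ≡ true
inI-true {k} {l} {r} {s} k≤r r≤k+l s≤l r+s≤k+l not-corner =
  cong₂ _∧_ (⌊⌋≡true (k ≤? r) k≤r) (cong₂ _∧_ (⌊⌋≡true (r ≤? k ℕ.+ l) r≤k+l)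
    (cong₂ _∧_ (⌊⌋≡true (s ≤? l) s≤l) (cong₂ _∧_ (⌊⌋≡true (r ℕ.+ s ≤? k ℕ.+ l) r+s≤k+l) corner)))
  where
  corner : not (⌊ r ℕ.≟ k ⌋ ∧ ⌊ s ℕ.≟ l ⌋) ≡ true
  corner with r ℕ.≟ k | s ℕ.≟ l
  ... | yes r≡k | yes s≡l = ⊥-elim (not-corner (r≡k , s≡l))
  ... | yes _   | no _    = refl
  ... | no _    | _       = refl

inI-beyond : ∀ {k l r s} → ¬ (r ℕ.+ s ≤ k ℕ.+ l) → inI k l r s ≡ false
inI-beyond {k} {l} {r} {s} r+s≰k+l =
  trans (cong (λ b → ⌊ k ≤? r ⌋ ∧ ⌊ r ≤? k ℕ.+ l ⌋ ∧ ⌊ s ≤? l ⌋ ∧ b ∧ not (⌊ r ℕ.≟ k ⌋ ∧ ⌊ s ℕ.≟ l ⌋))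
              (⌊⌋≡false (r ℕ.+ s ≤? k ℕ.+ l) r+s≰k+l))
        (fourth-false ⌊ k ≤? r ⌋ ⌊ r ≤? k ℕ.+ l ⌋ ⌊ s ≤? l ⌋ (not (⌊ r ℕ.≟ k ⌋ ∧ ⌊ s ℕ.≟ l ⌋)))
  where
  fourth-false : ∀ a b c e → a ∧ b ∧ c ∧ false ∧ e ≡ false
  fourth-false true  true  true  e = refl
  fourth-false true  true  false e = refl
  fourth-false true  false c     e = refl
  fourth-false false b     c     e = refl

inI-corner : ∀ k l → inI k l k l ≡ false
inI-corner k l =
  trans (cong (λ b → ⌊ k ≤? k ⌋ ∧ ⌊ k ≤? k ℕ.+ l ⌋ ∧ ⌊ l ≤? l ⌋ ∧ ⌊ k ℕ.+ l ≤? k ℕ.+ l ⌋ ∧ not b)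
              (cong₂ _∧_ (⌊⌋≡true (k ℕ.≟ k) refl) (⌊⌋≡true (l ℕ.≟ l) refl)))
        (fifth-false ⌊ k ≤? k ⌋ ⌊ k ≤? k ℕ.+ l ⌋ ⌊ l ≤? l ⌋ ⌊ k ℕ.+ l ≤? k ℕ.+ l ⌋)
  where
  fifth-false : ∀ a b c d → a ∧ b ∧ c ∧ d ∧ false ≡ false
  fifth-false true  true  true  true  = refl
  fifth-false true  true  true  false = refl
  fifth-false true  true  false d     = refl
  fifth-false true  false c     d     = refl
  fifth-false false b     c     d     = refl

module Correction (n : ℕ) (x : Fin (suc (suc n)) → ℚ) (x-injective : ∀ i j → x i ≡ x j → i ≡ j)
                  (n+1-odd : parity (suc n) ≡ 1ℚ) (t : ℕ → ℚ) (k′ l′ : ℕ) where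

  open TwoRows (suc n) x x-injective n+1-odd
  open TwoRowRecursion (suc n) x x-injective n+1-odd t
  open Symmetrisation n x x-injective n+1-odd t

  k = suc k′
  l = suc l′

  P1≡S₁ : ∀ r → P1 N t (suc r) x ≡ S₁ (fp (suc r))
  P1≡S₁ r = Pfun-row (suc r)

  S₁-Πt⁺-expansion : ∀ a e → let zs = tRange t a l; m = length zs ℕ.+ e in
    S₁ (λ y → pow y e * Πt⁺ a l y * fp k y) ≡ Σ< (suc m) (λ j → hh (m ∸ j) (tSeg t (suc k) (suc j)) zs * S₁ (fp (k ℕ.+ j)))
  S₁-Πt⁺-expansion a e = begin
    S₁ (λ y → pow y e * Πt⁺ a l y * fp k y)
      ≡⟨ S₁-cong _ _ (λ y → cong (λ p → pow y e * p * fp k y) (sym (prod-map (λ c → y + c) t (range a l)))) ⟩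
    S₁ (λ y → pow y e * Π⁺ y (tRange t a l) * fp k y)
      ≡⟨ S₁-cong _ _ (λ y → FactorialExpansion.pow-Π⁺-fpow-expansion t y (tRange t a l) e k) ⟩
    S₁ (λ y → Σ< (suc m) (λ j → hh (m ∸ j) (tSeg t (suc k) (suc j)) (tRange t a l) * fpow t y (k ℕ.+ j)))
      ≡⟨ S₁-Σ< (suc m) (λ j → hh (m ∸ j) (tSeg t (suc k) (suc j)) (tRange t a l)) (λ j y → fpow t y (k ℕ.+ j)) ⟩
    Σ< (suc m) (λ j → hh (m ∸ j) (tSeg t (suc k) (suc j)) (tRange t a l) * S₁ (fp (k ℕ.+ j))) ∎
    where
    m = length (tRange t a l) ℕ.+ e

  entry : ℕ → ℕ → ℚ
  entry r s = if inI k l r s then g t k l r s * P1 N t r x * P1 N t s x else 0ℚ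

  column : ℕ → ℚ
  column s = Σ< (suc l) (λ i → entry (k ℕ.+ i) s)

  [1+k+i]∸k≡1+i : ∀ i → suc (k ℕ.+ i) ∸ k ≡ suc i
  [1+k+i]∸k≡1+i i = trans (cong (_∸ k) (sym (ℕₚ.+-suc k i))) (ℕₚ.m+n∸m≡n k (suc i))

  correction-columns : correction N t k l x ≡ Σ< (suc l) column
  correction-columns = begin
    correction N t k l x
      ≡⟨ sum-concatMap (λ r → map (λ s → entry r s) (range 0 l)) (range k (k ℕ.+ l)) ⟩
    sumℚ (map (λ r → sumℚ (map (entry r) (range 0 l))) (range k (k ℕ.+ l)))
      ≡⟨ sum-swap entry (range k (k ℕ.+ l)) (range 0 l) ⟩
    sumℚ (map (λ s → sumℚ (map (λ r → entry r s) (range k (k ℕ.+ l)))) (range 0 l))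
      ≡⟨ sum-range (λ s → sumℚ (map (λ r → entry r s) (range k (k ℕ.+ l)))) 0 l ⟩
    Σ< (suc l) (λ s → sumℚ (map (λ r → entry r s) (range k (k ℕ.+ l))))
      ≡⟨ Σ<-ext (suc l) _ _ (λ s → trans (sum-range (λ r → entry r s) k (k ℕ.+ l)) (cong (λ m → Σ< m (λ i → entry (k ℕ.+ i) s)) ([1+k+i]∸k≡1+i l))) ⟩
    Σ< (suc l) column ∎

  column-0 : column 0 ≡ sgn l * S₁ (λ y → Πt⁺ 1 l y * fp k y)
  column-0 = begin
    column 0                                         ≡⟨ Σ<-cong (suc l) _ _ entry-0 ⟩
    Σ< (suc l) (λ i → sgn l * H i)                   ≡⟨ Σ<-*ˡ (suc l) (sgn l) H ⟩
    sgn l * Σ< (suc l) H                             ≡⟨ cong (sgn l *_) (sym expansion) ⟩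
    sgn l * S₁ (λ y → Πt⁺ 1 l y * fp k y)            ∎
    where
    zs = tRange t 1 l
    H : ℕ → ℚ
    H i = hh (l ∸ i) (tSeg t (suc k) (suc i)) zs * S₁ (fp (k ℕ.+ i))
    entry-0 : ∀ i → i < suc l → entry (k ℕ.+ i) 0 ≡ sgn l * H i
    entry-0 i (s≤s i≤l) = begin
      entry (k ℕ.+ i) 0
        ≡⟨ cong (λ b → if b then g t k l (k ℕ.+ i) 0 * P1 N t (k ℕ.+ i) x * 1ℚ else 0ℚ)
                (inI-true (ℕₚ.m≤m+n k i) (ℕₚ.+-monoʳ-≤ k i≤l) z≤n
                          (subst (_≤ k ℕ.+ l) (sym (ℕₚ.+-identityʳ (k ℕ.+ i))) (ℕₚ.+-monoʳ-≤ k i≤l)) (λ { (_ , ()) })) ⟩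
      sgn l * hh (k ℕ.+ l ∸ (k ℕ.+ i)) (tSeg t (suc k) (suc (k ℕ.+ i) ∸ k)) zs * P1 N t (k ℕ.+ i) x * 1ℚ
        ≡⟨ cong₂ (λ m ts → sgn l * hh m ts zs * P1 N t (k ℕ.+ i) x * 1ℚ) (ℕₚ.[m+n]∸[m+o]≡n∸o k l i) (cong (tSeg t (suc k)) ([1+k+i]∸k≡1+i i)) ⟩
      sgn l * hh (l ∸ i) (tSeg t (suc k) (suc i)) zs * P1 N t (k ℕ.+ i) x * 1ℚ
        ≡⟨ cong (λ p → sgn l * hh (l ∸ i) (tSeg t (suc k) (suc i)) zs * p * 1ℚ) (P1≡S₁ (k′ ℕ.+ i)) ⟩
      sgn l * hh (l ∸ i) (tSeg t (suc k) (suc i)) zs * S₁ (fp (k ℕ.+ i)) * 1ℚ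
        ≡⟨ reassoc (sgn l) _ _ ⟩
      sgn l * H i ∎
      where
      reassoc : ∀ a b c → a * b * c * 1ℚ ≡ a * (b * c)
      reassoc = solve-∀ ℚ-ring
    expansion : S₁ (λ y → Πt⁺ 1 l y * fp k y) ≡ Σ< (suc l) H
    expansion = begin
      S₁ (λ y → Πt⁺ 1 l y * fp k y)                    ≡⟨ S₁-cong _ _ (λ y → cong (_* fp k y) (sym (ℚₚ.*-identityˡ (Πt⁺ 1 l y)))) ⟩
      S₁ (λ y → pow y 0 * Πt⁺ 1 l y * fp k y)          ≡⟨ S₁-Πt⁺-expansion 1 0 ⟩
      Σ< (suc m) (λ j → hh (m ∸ j) (tSeg t (suc k) (suc j)) zs * S₁ (fp (k ℕ.+ j)))
                                                       ≡⟨ cong (λ m → Σ< (suc m) (λ j → hh (m ∸ j) (tSeg t (suc k) (suc j)) zs * S₁ (fp (k ℕ.+ j)))) m≡l ⟩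
      Σ< (suc l) H                                     ∎
      where
      m = length zs ℕ.+ 0
      m≡l : m ≡ l
      m≡l = trans (ℕₚ.+-identityʳ _) (length-tRange t 1 l)

  column-l : column l ≡ 0ℚ
  column-l = Σ<-0 (suc l) _ vanish
    where
    vanish : ∀ i → i < suc l → entry (k ℕ.+ i) l ≡ 0ℚ
    vanish zero    _ = cong (λ b → if b then g t k l (k ℕ.+ 0) l * P1 N t (k ℕ.+ 0) x * P1 N t l x else 0ℚ)
                            (trans (cong (λ r → inI k l r l) (ℕₚ.+-identityʳ k)) (inI-corner k l))
    vanish (suc i) _ = cong (λ b → if b then g t k l (k ℕ.+ suc i) l * P1 N t (k ℕ.+ suc i) x * P1 N t l x else 0ℚ)
                            (inI-beyond {k} {l} {k ℕ.+ suc i} {l} (ℕₚ.<⇒≱ (ℕₚ.+-monoˡ-< l (ℕₚ.m<m+n k (s≤s (z≤n {i}))))))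

  module _ (s′ : ℕ) (s′<l′ : s′ < l′) where

    private
      s = suc s′
      d = l ∸ s
      s<l : s < l
      s<l = s≤s s′<l′
      l≡d+s : l ≡ d ℕ.+ s
      l≡d+s = sym (ℕₚ.m∸n+n≡m (ℕₚ.<⇒≤ s<l))
      zs = tRange t (suc s′ ℕ.+ 2) l
      H : ℕ → ℚ
      H i = hh (d ∸ i) (tSeg t (suc k) (suc i)) zs * S₁ (fp (k ℕ.+ i))

    column-mid-entry : ∀ i → i < suc d → entry (k ℕ.+ i) s ≡ two * sgn d * S₁ (fp s) * H i
    column-mid-entry i (s≤s i≤d) = begin
      entry (k ℕ.+ i) s
        ≡⟨ cong (λ b → if b then g t k l (k ℕ.+ i) s * P1 N t (k ℕ.+ i) x * P1 N t s x else 0ℚ)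
                (inI-true (ℕₚ.m≤m+n k i) (ℕₚ.+-monoʳ-≤ k (ℕₚ.≤-trans i≤d (ℕₚ.m∸n≤m l s))) (ℕₚ.<⇒≤ s<l) k+i+s≤k+l
                          (λ { (_ , s≡l) → ℕₚ.<-irrefl s≡l s<l })) ⟩
      sgn d * two * hh (k ℕ.+ l ∸ (k ℕ.+ i ℕ.+ s)) (tSeg t (suc k) (suc (k ℕ.+ i) ∸ k)) zs * P1 N t (k ℕ.+ i) x * P1 N t s x
        ≡⟨ cong₂ (λ m ts → sgn d * two * hh m ts zs * P1 N t (k ℕ.+ i) x * P1 N t s x) degree (cong (tSeg t (suc k)) ([1+k+i]∸k≡1+i i)) ⟩
      sgn d * two * hh (d ∸ i) (tSeg t (suc k) (suc i)) zs * P1 N t (k ℕ.+ i) x * P1 N t s x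
        ≡⟨ cong₂ (λ u v → sgn d * two * hh (d ∸ i) (tSeg t (suc k) (suc i)) zs * u * v) (P1≡S₁ (k′ ℕ.+ i)) (P1≡S₁ s′) ⟩
      sgn d * two * hh (d ∸ i) (tSeg t (suc k) (suc i)) zs * S₁ (fp (k ℕ.+ i)) * S₁ (fp s)
        ≡⟨ regroup (sgn d) two _ _ _ ⟩
      two * sgn d * S₁ (fp s) * H i ∎
      where
      k+i+s≤k+l : k ℕ.+ i ℕ.+ s ≤ k ℕ.+ l
      k+i+s≤k+l = subst₂ _≤_ (sym (ℕₚ.+-assoc k i s)) (cong (k ℕ.+_) (sym l≡d+s)) (ℕₚ.+-monoʳ-≤ k (ℕₚ.+-monoˡ-≤ s i≤d))
      degree : k ℕ.+ l ∸ (k ℕ.+ i ℕ.+ s) ≡ d ∸ i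
      degree = begin
        k ℕ.+ l ∸ (k ℕ.+ i ℕ.+ s)     ≡⟨ cong (k ℕ.+ l ∸_) (ℕₚ.+-assoc k i s) ⟩
        k ℕ.+ l ∸ (k ℕ.+ (i ℕ.+ s))   ≡⟨ ℕₚ.[m+n]∸[m+o]≡n∸o k l (i ℕ.+ s) ⟩
        l ∸ (i ℕ.+ s)                 ≡⟨ cong (l ∸_) (ℕₚ.+-comm i s) ⟩
        l ∸ (s ℕ.+ i)                 ≡⟨ sym (ℕₚ.∸-+-assoc l s i) ⟩
        d ∸ i                         ∎
      regroup : ∀ a b h p q → a * b * h * p * q ≡ b * a * q * (h * p)
      regroup = solve-∀ ℚ-ring

    column-mid-beyond : ∀ i → entry (k ℕ.+ (suc d ℕ.+ i)) s ≡ 0ℚ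
    column-mid-beyond i = cong (λ b → if b then g t k l r s * P1 N t r x * P1 N t s x else 0ℚ)
                               (inI-beyond {k} {l} {r} {s} (ℕₚ.<⇒≱ (subst (k ℕ.+ l <_) (sym r+s) (ℕₚ.m<m+n (k ℕ.+ l) (s≤s (z≤n {i}))))))
      where
      r = k ℕ.+ (suc d ℕ.+ i)
      r+s : r ℕ.+ s ≡ k ℕ.+ l ℕ.+ suc i
      r+s = trans (rearrange k d i s) (cong (λ m → k ℕ.+ m ℕ.+ suc i) (sym l≡d+s))
        where
        rearrange : ∀ k d i s → k ℕ.+ (suc d ℕ.+ i) ℕ.+ s ≡ k ℕ.+ (d ℕ.+ s) ℕ.+ suc i
        rearrange = ℕ-Solver.solve-∀

    column-mid-expansion : S₁ (λ y → y * Πt⁺ (suc (suc s)) l y * fp k y) ≡ Σ< (suc d) H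
    column-mid-expansion = begin
      S₁ (λ y → y * Πt⁺ (suc (suc s)) l y * fp k y)
        ≡⟨ S₁-cong _ _ (λ y → trans (pad y (Πt⁺ (suc (suc s)) l y) (fp k y)) (cong (λ a → y * 1ℚ * Πt⁺ a l y * fp k y) (cong suc (ℕₚ.+-comm 2 s′)))) ⟩
      S₁ (λ y → pow y 1 * Πt⁺ (suc s′ ℕ.+ 2) l y * fp k y)
        ≡⟨ S₁-Πt⁺-expansion (suc s′ ℕ.+ 2) 1 ⟩
      Σ< (suc m) (λ j → hh (m ∸ j) (tSeg t (suc k) (suc j)) zs * S₁ (fp (k ℕ.+ j)))
        ≡⟨ cong (λ m → Σ< (suc m) (λ j → hh (m ∸ j) (tSeg t (suc k) (suc j)) zs * S₁ (fp (k ℕ.+ j)))) m≡d ⟩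
      Σ< (suc d) H ∎
      where
      pad : ∀ y v f → y * v * f ≡ y * 1ℚ * v * f
      pad = solve-∀ ℚ-ring
      m = length zs ℕ.+ 1
      m≡d : m ≡ d
      m≡d = begin
        length zs ℕ.+ 1             ≡⟨ cong (ℕ._+ 1) (length-tRange t (suc s′ ℕ.+ 2) l) ⟩
        l ∸ (s′ ℕ.+ 2) ℕ.+ 1        ≡⟨ cong (λ a → l ∸ a ℕ.+ 1) (ℕₚ.+-comm s′ 2) ⟩
        l ∸ suc s ℕ.+ 1             ≡⟨ ℕₚ.+-comm (l ∸ suc s) 1 ⟩
        suc (l ∸ suc s)             ≡⟨ sym (m∸n≡suc[m∸suc[n]] l s s<l) ⟩
        d                           ∎

    column-mid : column s ≡ two * sgn d * S₁ (λ y → y * Πt⁺ (suc (suc s)) l y * fp k y) * S₁ (fp s)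
    column-mid = begin
      Σ< (suc l) G                                   ≡⟨ cong (λ m → Σ< m G) (cong suc l≡d+s) ⟩
      Σ< (suc d ℕ.+ s) G                             ≡⟨ Σ<-split (suc d) s G ⟩
      Σ< (suc d) G + Σ< s (λ i → G (suc d ℕ.+ i))   ≡⟨ cong₂ _+_ (Σ<-cong (suc d) G (λ i → c * H i) column-mid-entry) (Σ<-0 s _ (λ i _ → column-mid-beyond i)) ⟩
      Σ< (suc d) (λ i → c * H i) + 0ℚ                ≡⟨ ℚₚ.+-identityʳ _ ⟩
      Σ< (suc d) (λ i → c * H i)                     ≡⟨ Σ<-*ˡ (suc d) c H ⟩
      c * Σ< (suc d) H                               ≡⟨ cong (c *_) (sym column-mid-expansion) ⟩
      two * sgn d * S₁ (fp s) * S₁ (λ y → y * Πt⁺ (suc (suc s)) l y * fp k y)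
                                                     ≡⟨ swap-last two (sgn d) _ _ ⟩
      two * sgn d * S₁ (λ y → y * Πt⁺ (suc (suc s)) l y * fp k y) * S₁ (fp s) ∎
      where
      G : ℕ → ℚ
      G i = entry (k ℕ.+ i) s
      c = two * sgn d * S₁ (fp s)
      swap-last : ∀ a b p q → a * b * p * q ≡ a * b * q * p
      swap-last = solve-∀ ℚ-ring

  correction-S₁ : correction N t k l x ≡ sgn l * S₁ (λ y → Πt⁺ 1 l y * fp k y) + crossTerms (fp k) l
  correction-S₁ = begin
    correction N t k l x                                   ≡⟨ correction-columns ⟩
    column 0 + Σ< l (column ∘ suc)                         ≡⟨ cong (column 0 +_) (Σ<-snoc l′ (column ∘ suc)) ⟩
    column 0 + (Σ< l′ (column ∘ suc) + column l)           ≡⟨ cong₂ (λ u v → u + (v + column l)) column-0 (Σ<-cong l′ _ _ column-mid) ⟩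
    sgn l * S₁ (λ y → Πt⁺ 1 l y * fp k y) + (crossTerms (fp k) l + column l)
                                                           ≡⟨ cong (λ v → sgn l * S₁ (λ y → Πt⁺ 1 l y * fp k y) + (crossTerms (fp k) l + v)) column-l ⟩
    sgn l * S₁ (λ y → Πt⁺ 1 l y * fp k y) + (crossTerms (fp k) l + 0ℚ)
                                                           ≡⟨ cong (sgn l * S₁ (λ y → Πt⁺ 1 l y * fp k y) +_) (ℚₚ.+-identityʳ _) ⟩
    sgn l * S₁ (λ y → Πt⁺ 1 l y * fp k y) + crossTerms (fp k) l ∎

  Pfun-two-rows-decomposition : Pfun N t (k ∷ l ∷ []) x ≡ P1 N t k x * P1 N t l x + correction N t k l x
  Pfun-two-rows-decomposition = begin
    Pfun N t (k ∷ l ∷ []) x                                  ≡⟨ Pfun-two-rows k l ⟩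
    S₂ (fp k) (fp l)                                         ≡⟨ S₂-fpow l (fp k) ⟩
    S₁ (fp k) * S₁ (fp l) + sgn l * S₁ (λ y → Πt⁺ 1 l y * fp k y) + crossTerms (fp k) l
                                                             ≡⟨ ℚₚ.+-assoc (S₁ (fp k) * S₁ (fp l)) _ _ ⟩
    S₁ (fp k) * S₁ (fp l) + (sgn l * S₁ (λ y → Πt⁺ 1 l y * fp k y) + crossTerms (fp k) l)
                                                             ≡⟨ cong₂ _+_ (sym (cong₂ _*_ (P1≡S₁ k′) (P1≡S₁ l′))) (sym correction-S₁) ⟩
    P1 N t k x * P1 N t l x + correction N t k l x           ∎

-- The hypothesis l ≤ k is only used to rule out k = 0, where P1 is 1 by convention.
proposition2p1 : (k l : ℕ) → 1 ≤ l → l ≤ k →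
    (N : ℕ) → 2 ∣ N → 2 ≤ N →
    (x : Fin N → ℚ) → (∀ i j → x i ≡ x j → i ≡ j) →
    (t : ℕ → ℚ) →
    Pfun N t (k ∷ l ∷ []) x
      ≡ P1 N t k x * P1 N t l x + correction N t k l x
proposition2p1 (suc _) (suc _) _ _ 1 _ (s≤s ())
proposition2p1 (suc k′) (suc l′) _ _ (suc (suc n)) (divides q N≡q*2) _ x x-injective t =
  Correction.Pfun-two-rows-decomposition n x x-injective n+1-odd t k′ l′
  where
  n+1-odd : parity (suc n) ≡ 1ℚ
  n+1-odd = begin
    parity (suc n)                    ≡⟨ involutive (parity (suc n)) ⟩
    1ℚ - parity (suc (suc n))         ≡⟨ cong (λ p → 1ℚ - p) (trans (cong parity N≡q*2) (parity-even q)) ⟩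
    1ℚ - 0ℚ                           ≡⟨⟩
    1ℚ                                ∎
    where
    involutive : ∀ p → p ≡ 1ℚ - (1ℚ - p)
    involutive = solve-∀ ℚ-ring
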